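{- Let $d,n$ be positive integers and $0\le k\le n$ an integer. Then $$\det\left(\binom{n+d+j-i-1}{n-1}_{F(s,t)}\right)_{i,j=0}^{k-1}=(-t)^{\binom{k}{2}d}\left\langle \begin{matrix} n\\ k\end{matrix}\right\rangle_{d,F(s,t)}.$$
   Context: $s,t$ are indeterminates. Fibonacci polynomials: $F_0(s,t)=0$, $F_1(s,t)=1$, $F_n(s,t)=sF_{n-1}(s,t)+tF_{n-2}(s,t)$. Fibonomials: $\binom{m}{k}_{F(s,t)}=\prod_{j=0}^{k-1}\frac{F_{m-j}(s,t)}{F_{k-j}(s,t)}$ for $0\le k\le m$, and $0$ if $k<0$ or $k>m$. Hoggatt coefficients: for $0\le k\le n$, $\left\langle \begin{matrix} n\\ k\end{matrix}\right\rangle_{d,F(s,t)}=\prod_{j=0}^{k-1}\frac{\binom{n-j+d-1}{d}_{F(s,t)}}{\binom{k-j+d-1}{d}_{F(s,t)}}$. A $0\times0$ determinant equals $1$. -}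

module Defs where

open import Level using (Level; _⊔_)
open import Data.Nat using (ℕ; zero; suc; _≤?_; _∸_)
import Data.Nat as ℕ
open import Data.Fin using (Fin; zero; suc; punchIn)
open import Relation.Nullary using (¬_; yes; no)
open import Algebra.Bundles using (CommutativeRing)

-- A (discrete) field: a commutative ring with 0 ≠ 1 in which every
-- nonzero element has a multiplicative inverse (given by a total
-- operation _⁻¹ whose value at 0 is irrelevant).
record Field (c ℓ : Level) : Set (Level.suc (c ⊔ ℓ)) where
  field
    commutativeRing : CommutativeRing c ℓ
  open CommutativeRing commutativeRing public
  field
    _⁻¹      : Carrier → Carrier
    0≉1      : ¬ (0# ≈ 1#)
    ⁻¹-inverseʳ : ∀ x → ¬ (x ≈ 0#) → x * (x ⁻¹) ≈ 1#

module FieldDefs {c ℓ : Level} (K : Field c ℓ) where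
  open Field K using (Carrier; _+_; _*_; -_; 0#; 1#; _⁻¹)

  infixl 7 _/_
  _/_ : Carrier → Carrier → Carrier
  a / b = a * (b ⁻¹)

  pow : Carrier → ℕ → Carrier
  pow x zero    = 1#
  pow x (suc n) = pow x n * x

  prod : ℕ → (ℕ → Carrier) → Carrier
  prod zero    f = 1#
  prod (suc k) f = prod k f * f k

  sumFin : ∀ n → (Fin n → Carrier) → Carrier
  sumFin zero    f = 0#
  sumFin (suc n) f = f zero + sumFin n (λ j → f (suc j))

  sign : ∀ {n} → Fin n → Carrier
  sign zero    = 1#
  sign (suc j) = - sign j

  det : ∀ n → (Fin n → Fin n → Carrier) → Carrier
  det zero    M = 1#
  det (suc n) M =
    sumFin (suc n) (λ j → sign j * M zero j * det n (λ a b → M (suc a) (punchIn j b)))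

  F : Carrier → Carrier → ℕ → Carrier
  F s t zero          = 0#
  F s t (suc zero)    = 1#
  F s t (suc (suc n)) = s * F s t (suc n) + t * F s t n

  fibonomial : Carrier → Carrier → ℕ → ℕ → Carrier
  fibonomial s t m k with k ≤? m
  ... | yes _ = prod k (λ j → F s t (m ∸ j) / F s t (k ∸ j))
  ... | no  _ = 0#

  hoggatt : Carrier → Carrier → ℕ → ℕ → ℕ → Carrier
  hoggatt s t d n k =
    prod k (λ j → fibonomial s t (n ∸ j ℕ.+ d ∸ 1) d / fibonomial s t (k ∸ j ℕ.+ d ∸ 1) d)

-- Write [m; k] for the fibonomial and n = N + 1, so that the matrix is M_N = ([N + d + j - i; N])_{i,j}.
-- Adding -F(N + d + j) / F(d + j) times column j - 1 to column j, for j = k - 1, ..., 1, turns the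
-- first row into ([N + d; d], 0, ..., 0) by absorption.  By Vajda's identity
-- F(b + a) F(c + a) = F(a) F(c + b + a) + (-t)^a F(b) F(c), the entry in row a + 1 and column b + 1
-- becomes F(a + 1) (-t)^(d + b - a) (M_{N-1})_{a,b} / F(d + b + 1), which vanishes when d + b < a.
-- Taking the row factors, the column factors and the powers of -t out of this minor gives
--   det_k M_N = [N + d; d] / [k - 1 + d; d] * (-t)^((k - 1) d) * det_{k-1} M_{N-1},
-- and induction on k yields the Hoggatt product together with the sign (-t)^(binom(k, 2) d).

module Submission where

open import Level using (Level)
open import Data.Nat using (ℕ; zero; suc; _∸_; _≤_; _<_; z≤n; s≤s)
import Data.Nat as ℕ
import Data.Nat.Properties as ℕₚ
open import Data.Nat.Combinatorics using (_C_; nC1≡n; nCk+nC[k+1]≡[n+1]C[k+1])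
open import Data.Nat.Tactic.RingSolver using (solve-∀)
open import Data.Integer as ℤ using (ℤ; +_; -[1+_])
import Data.Integer.Properties as ℤ
open import Data.Sign as Sign using (Sign)
open import Data.Fin using (Fin; toℕ)
import Data.Fin as Fin
open import Data.Maybe using (Maybe; just; nothing)
open import Data.Product using (∃; _×_; _,_; proj₁)
open import Data.Empty using (⊥-elim)
open import Function using (_∘_)
open import Relation.Binary.PropositionalEquality as ≡ using (_≡_; _≢_)
open import Relation.Binary.Definitions using (tri<; tri≈; tri>)
open import Relation.Nullary using (¬_; yes; no)
open import Algebra.Bundles using (CommutativeRing)
open import Algebra.Solver.Ring.AlmostCommutativeRing using (fromCommutativeRing; _-Raw-AlmostCommutative⟶_)
open import Algebra.Properties.CommutativeSemigroup ℕₚ.+-commutativeSemigroup using (x∙yz≈y∙xz; interchange)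
open import Defs

punchIn : ℕ → ℕ → ℕ
punchIn zero    b       = suc b
punchIn (suc l) zero    = zero
punchIn (suc l) (suc b) = suc (punchIn l b)

punchOut : ℕ → ℕ → ℕ
punchOut zero    zero    = zero
punchOut zero    (suc c) = c
punchOut (suc l) zero    = zero
punchOut (suc l) (suc c) = suc (punchOut l c)

punchInᵢ≢i : ∀ l b → punchIn l b ≢ l
punchInᵢ≢i (suc l) (suc b) eq = punchInᵢ≢i l b (ℕₚ.suc-injective eq)

punchIn-injective : ∀ l {b b′} → punchIn l b ≡ punchIn l b′ → b ≡ b′
punchIn-injective zero    eq = ℕₚ.suc-injective eq
punchIn-injective (suc l) {zero}  {zero}   _  = ≡.refl
punchIn-injective (suc l) {suc b} {suc b′} eq =
  ≡.cong suc (punchIn-injective l (ℕₚ.suc-injective eq))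

punchIn-punchOut : ∀ {l c} → c ≢ l → punchIn l (punchOut l c) ≡ c
punchIn-punchOut {zero}  {zero}  c≢l = ⊥-elim (c≢l ≡.refl)
punchIn-punchOut {zero}  {suc c} _   = ≡.refl
punchIn-punchOut {suc l} {zero}  _   = ≡.refl
punchIn-punchOut {suc l} {suc c} c≢l = ≡.cong suc (punchIn-punchOut (c≢l ∘ ≡.cong suc))

punchIn-mono-< : ∀ {n} l {b} → b < n → punchIn l b < suc n
punchIn-mono-< zero                b<n       = s≤s b<n
punchIn-mono-< {suc n} (suc l) {zero}  _         = s≤s z≤n
punchIn-mono-< {suc n} (suc l) {suc b} (s≤s b<n) = s≤s (punchIn-mono-< l b<n)

punchIn-cancel-< : ∀ {n l b} → l < suc n → punchIn l b < suc n → b < n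
punchIn-cancel-< {n}     {zero}          _           (s≤s b<n) = b<n
punchIn-cancel-< {zero}  {suc l}         (s≤s ())    _
punchIn-cancel-< {suc n} {suc l} {zero}  _           _         = s≤s z≤n
punchIn-cancel-< {suc n} {suc l} {suc b} (s≤s l<1+n) (s≤s lt)  = s≤s (punchIn-cancel-< l<1+n lt)

punchIn-adjacent : ∀ {l p} → l ≢ p → l ≢ suc p →
  ∃ λ q → punchIn l q ≡ p × punchIn l (suc q) ≡ suc p
punchIn-adjacent {zero}  {zero}  l≢p _     = ⊥-elim (l≢p ≡.refl)
punchIn-adjacent {zero}  {suc p} _   _     = p , ≡.refl , ≡.refl
punchIn-adjacent {suc zero} {zero} _ l≢1+p = ⊥-elim (l≢1+p ≡.refl)
punchIn-adjacent {suc (suc l)} {zero} _ _  = zero , ≡.refl , ≡.refl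
punchIn-adjacent {suc l} {suc p} l≢p l≢1+p with punchIn-adjacent (l≢p ∘ ≡.cong suc) (l≢1+p ∘ ≡.cong suc)
... | q , eq₀ , eq₁ = suc q , ≡.cong suc eq₀ , ≡.cong suc eq₁

∑ℕ : ℕ → (ℕ → ℕ) → ℕ
∑ℕ zero    f = 0
∑ℕ (suc n) f = f 0 ℕ.+ ∑ℕ n (f ∘ suc)

∑ℕ-punchIn : ∀ n {l} (f : ℕ → ℕ) → l < suc n → ∑ℕ (suc n) f ≡ f l ℕ.+ ∑ℕ n (f ∘ punchIn l)
∑ℕ-punchIn n       {zero}  f _ = ≡.refl
∑ℕ-punchIn (suc n) {suc l} f (s≤s l<1+n) = begin
  f 0 ℕ.+ ∑ℕ (suc n) (f ∘ suc)                       ≡⟨ ≡.cong (f 0 ℕ.+_) (∑ℕ-punchIn n (f ∘ suc) l<1+n) ⟩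
  f 0 ℕ.+ (f (suc l) ℕ.+ ∑ℕ n (f ∘ suc ∘ punchIn l)) ≡⟨ x∙yz≈y∙xz (f 0) (f (suc l)) _ ⟩
  f (suc l) ℕ.+ (f 0 ℕ.+ ∑ℕ n (f ∘ suc ∘ punchIn l)) ∎
  where open ≡.≡-Reasoning

∑ℕ-shift : ∀ n d (f : ℕ → ℕ) → ∑ℕ n (λ b → d ℕ.+ f b) ≡ n ℕ.* d ℕ.+ ∑ℕ n f
∑ℕ-shift zero    d f = ≡.refl
∑ℕ-shift (suc n) d f = begin
  d ℕ.+ f 0 ℕ.+ ∑ℕ n (λ b → d ℕ.+ f (suc b))  ≡⟨ ≡.cong (d ℕ.+ f 0 ℕ.+_) (∑ℕ-shift n d (f ∘ suc)) ⟩
  d ℕ.+ f 0 ℕ.+ (n ℕ.* d ℕ.+ ∑ℕ n (f ∘ suc))  ≡⟨ interchange d (f 0) (n ℕ.* d) _ ⟩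
  d ℕ.+ n ℕ.* d ℕ.+ ∑ℕ (suc n) f               ∎
  where open ≡.≡-Reasoning

+-∸-interchange : ∀ {a b x y} → b ≤ a → y ≤ x → (a ∸ b) ℕ.+ (x ∸ y) ≡ (a ℕ.+ x) ∸ (b ℕ.+ y)
+-∸-interchange {a}     {zero}  z≤n       y≤x = ≡.sym (ℕₚ.+-∸-assoc a y≤x)
+-∸-interchange {suc a} {suc b} (s≤s b≤a) y≤x = +-∸-interchange b≤a y≤x

+-cancel-<-≥ : ∀ {a x b y} → a ℕ.+ x < b ℕ.+ y → b ≤ a → x < y
+-cancel-<-≥ lt b≤a = ℕₚ.≰⇒> λ y≤x → ℕₚ.<⇒≱ lt (ℕₚ.+-mono-≤ b≤a y≤x)

m+[n+o]∸n≡m+o : ∀ m n o → m ℕ.+ (n ℕ.+ o) ∸ n ≡ m ℕ.+ o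
m+[n+o]∸n≡m+o m n o = ≡.trans (≡.cong (_∸ n) (x∙yz≈y∙xz m n o)) (ℕₚ.m+n∸m≡n n (m ℕ.+ o))

m+n∸o<m : ∀ {m n o} → n < o → o ≤ m → m ℕ.+ n ∸ o < m
m+n∸o<m {m} {n} {o} n<o o≤m = ≡.subst (m ℕ.+ n ∸ o <_) (ℕₚ.m+n∸n≡m m o)
  (ℕₚ.∸-monoˡ-< (ℕₚ.+-monoʳ-< m n<o) (ℕₚ.≤-trans o≤m (ℕₚ.m≤m+n m n)))

1+m+1+[n+1+o]≡1+n+[1+m+1+o] : ∀ m n o → suc m ℕ.+ suc (n ℕ.+ suc o) ≡ suc n ℕ.+ (suc m ℕ.+ suc o)
1+m+1+[n+1+o]≡1+n+[1+m+1+o] = solve-∀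

[1+k]C2≡k+kC2 : ∀ k → suc k C 2 ≡ k ℕ.+ k C 2
[1+k]C2≡k+kC2 k = ≡.trans (≡.sym (nCk+nC[k+1]≡[n+1]C[k+1] k 1)) (≡.cong (ℕ._+ k C 2) (nC1≡n k))

n≤1+pred[n] : ∀ n → n ≤ suc (ℕ.pred n)
n≤1+pred[n] zero    = z≤n
n≤1+pred[n] (suc n) = ℕₚ.≤-refl

-- The ring solver needs coefficients with decidable equality; ℤ maps into every commutative ring.
module IntegerCoefficientSolver {c ℓ : Level} (R : CommutativeRing c ℓ) where
  open CommutativeRing R
  open import Algebra.Properties.Ring ring
    using (-‿involutive; -0#≈0#; -‿distribˡ-*; -‿distribʳ-*; -‿+-comm)
  open import Algebra.Properties.Semiring.Mult semiring using (×-homo-+; ×1-homo-*)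
    renaming (_×_ to _·_)
  open import Relation.Binary.Reasoning.Setoid setoid

  ⟦_⟧ : ℤ → Carrier
  ⟦ + n ⟧      = n · 1#
  ⟦ -[1+ n ] ⟧ = - (suc n · 1#)

  ⟦⟧-homo-neg : ∀ i → ⟦ ℤ.- i ⟧ ≈ - ⟦ i ⟧
  ⟦⟧-homo-neg -[1+ n ]   = sym (-‿involutive _)
  ⟦⟧-homo-neg (+ 0)      = sym -0#≈0#
  ⟦⟧-homo-neg (+ suc n)  = refl

  -‿cancel-1+ : ∀ x y → (1# + x) - (1# + y) ≈ x - y
  -‿cancel-1+ x y = begin
    (1# + x) - (1# + y)       ≈⟨ +-congˡ (sym (-‿+-comm 1# y)) ⟩
    (1# + x) + (- 1# - y)     ≈⟨ +-assoc 1# x _ ⟩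
    1# + (x + (- 1# - y))     ≈⟨ +-congˡ (trans (sym (+-assoc x _ _)) (+-congʳ (+-comm x _))) ⟩
    1# + ((- 1# + x) - y)     ≈⟨ +-congˡ (+-assoc _ x _) ⟩
    1# + (- 1# + (x - y))     ≈⟨ sym (+-assoc 1# _ _) ⟩
    (1# - 1#) + (x - y)       ≈⟨ +-congʳ (-‿inverseʳ 1#) ⟩
    0# + (x - y)              ≈⟨ +-identityˡ _ ⟩
    x - y                     ∎

  ⟦⟧-homo-⊖ : ∀ m n → ⟦ m ℤ.⊖ n ⟧ ≈ m · 1# - n · 1#
  ⟦⟧-homo-⊖ m 0 = begin
    ⟦ m ℤ.⊖ 0 ⟧    ≡⟨ ≡.cong ⟦_⟧ (ℤ.≤-⊖ (ℕ.z≤n {m})) ⟩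
    m · 1#         ≈⟨ sym (+-identityʳ _) ⟩
    m · 1# + 0#    ≈⟨ +-congˡ (sym -0#≈0#) ⟩
    m · 1# - 0#    ∎
  ⟦⟧-homo-⊖ 0 (suc n) = sym (+-identityˡ _)
  ⟦⟧-homo-⊖ (suc m) (suc n) = begin
    ⟦ suc m ℤ.⊖ suc n ⟧   ≡⟨ ≡.cong ⟦_⟧ (ℤ.[1+m]⊖[1+n]≡m⊖n m n) ⟩
    ⟦ m ℤ.⊖ n ⟧           ≈⟨ ⟦⟧-homo-⊖ m n ⟩
    m · 1# - n · 1#       ≈⟨ sym (-‿cancel-1+ _ _) ⟩
    suc m · 1# - suc n · 1# ∎

  ⟦⟧-homo-+ : ∀ i j → ⟦ i ℤ.+ j ⟧ ≈ ⟦ i ⟧ + ⟦ j ⟧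
  ⟦⟧-homo-+ -[1+ m ] -[1+ n ] = begin
    - (suc (suc (m ℕ.+ n)) · 1#)       ≡⟨ ≡.cong (λ k → - (suc k · 1#)) (≡.sym (ℕₚ.+-suc m n)) ⟩
    - ((suc m ℕ.+ suc n) · 1#)         ≈⟨ -‿cong (×-homo-+ 1# (suc m) (suc n)) ⟩
    - (suc m · 1# + suc n · 1#)        ≈⟨ sym (-‿+-comm _ _) ⟩
    - (suc m · 1#) - (suc n · 1#)      ∎
  ⟦⟧-homo-+ -[1+ m ] (+ n)    = trans (⟦⟧-homo-⊖ n (suc m)) (+-comm _ _)
  ⟦⟧-homo-+ (+ m)    -[1+ n ] = ⟦⟧-homo-⊖ m (suc n)
  ⟦⟧-homo-+ (+ m)    (+ n)    = ×-homo-+ 1# m n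

  signed : Sign → Carrier → Carrier
  signed Sign.+ x = x
  signed Sign.- x = - x

  signed-cong : ∀ σ {x y} → x ≈ y → signed σ x ≈ signed σ y
  signed-cong Sign.+ x≈y = x≈y
  signed-cong Sign.- x≈y = -‿cong x≈y

  ⟦⟧-◃ : ∀ σ n → ⟦ σ ℤ.◃ n ⟧ ≈ signed σ (n · 1#)
  ⟦⟧-◃ Sign.+ 0       = refl
  ⟦⟧-◃ Sign.- 0       = sym -0#≈0#
  ⟦⟧-◃ Sign.+ (suc n) = refl
  ⟦⟧-◃ Sign.- (suc n) = refl

  ⟦⟧-signAbs : ∀ i → ⟦ i ⟧ ≈ signed (ℤ.sign i) (ℤ.∣ i ∣ · 1#)
  ⟦⟧-signAbs (+ n)     = refl
  ⟦⟧-signAbs -[1+ n ]  = refl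

  signed-* : ∀ σ τ x y → signed (σ Sign.* τ) (x * y) ≈ signed σ x * signed τ y
  signed-* Sign.+ Sign.+ x y = refl
  signed-* Sign.+ Sign.- x y = -‿distribʳ-* x y
  signed-* Sign.- Sign.+ x y = -‿distribˡ-* x y
  signed-* Sign.- Sign.- x y = begin
    x * y           ≈⟨ sym (-‿involutive _) ⟩
    - - (x * y)     ≈⟨ -‿cong (-‿distribˡ-* x y) ⟩
    - (- x * y)     ≈⟨ -‿distribʳ-* (- x) y ⟩
    - x * - y       ∎

  ⟦⟧-homo-* : ∀ i j → ⟦ i ℤ.* j ⟧ ≈ ⟦ i ⟧ * ⟦ j ⟧
  ⟦⟧-homo-* i j = begin
    ⟦ σ Sign.* τ ℤ.◃ ∣i∣ ℕ.* ∣j∣ ⟧        ≈⟨ ⟦⟧-◃ (σ Sign.* τ) (∣i∣ ℕ.* ∣j∣) ⟩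
    signed (σ Sign.* τ) ((∣i∣ ℕ.* ∣j∣) · 1#)  ≈⟨ signed-cong (σ Sign.* τ) (×1-homo-* ∣i∣ ∣j∣) ⟩
    signed (σ Sign.* τ) (∣i∣ · 1# * ∣j∣ · 1#) ≈⟨ signed-* σ τ _ _ ⟩
    signed σ (∣i∣ · 1#) * signed τ (∣j∣ · 1#) ≈⟨ *-cong (sym (⟦⟧-signAbs i)) (sym (⟦⟧-signAbs j)) ⟩
    ⟦ i ⟧ * ⟦ j ⟧                             ∎
    where
    σ = ℤ.sign i
    τ = ℤ.sign j
    ∣i∣ = ℤ.∣ i ∣
    ∣j∣ = ℤ.∣ j ∣

  ⟦⟧-morphism : ℤ.+-*-rawRing -Raw-AlmostCommutative⟶ fromCommutativeRing R
  ⟦⟧-morphism = record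
    { ⟦_⟧ = ⟦_⟧ ; +-homo = ⟦⟧-homo-+ ; *-homo = ⟦⟧-homo-* ; -‿homo = ⟦⟧-homo-neg
    ; 0-homo = refl ; 1-homo = +-identityʳ 1# }

  ⟦⟧-≟ : ∀ i j → Maybe (⟦ i ⟧ ≈ ⟦ j ⟧)
  ⟦⟧-≟ i j with i ℤ.≟ j
  ... | yes i≡j = just (reflexive (≡.cong ⟦_⟧ i≡j))
  ... | no  _   = nothing

  open import Algebra.Solver.Ring ℤ.+-*-rawRing (fromCommutativeRing R) ⟦⟧-morphism ⟦⟧-≟ public
    using (solve; _:=_; _:+_; _:*_; :-_; con)

module Determinant {c ℓ : Level} (R : CommutativeRing c ℓ) where
  open CommutativeRing R hiding (zero)
  open IntegerCoefficientSolver R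
  open import Algebra.Properties.Semiring.Exp semiring using (_^_; ^-homo-*)
  open import Relation.Binary.Reasoning.Setoid setoid

  ≈0⇒*≈0ˡ : ∀ {x y} → x ≈ 0# → x * y ≈ 0#
  ≈0⇒*≈0ˡ x≈0 = trans (*-congʳ x≈0) (zeroˡ _)

  ≈0⇒*≈0ʳ : ∀ {x y} → y ≈ 0# → x * y ≈ 0#
  ≈0⇒*≈0ʳ y≈0 = trans (*-congˡ y≈0) (zeroʳ _)

  -- ℕ-indexed matrices keep minors and column operations free of Fin bookkeeping;
  -- det′ n only reads the leading n × n block.
  Matrix : Set c
  Matrix = ℕ → ℕ → Carrier

  ∑ : ℕ → (ℕ → Carrier) → Carrier
  ∑ zero    f = 0#
  ∑ (suc n) f = f 0 + ∑ n (f ∘ suc)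

  ∏ : ℕ → (ℕ → Carrier) → Carrier
  ∏ zero    f = 1#
  ∏ (suc n) f = f 0 * ∏ n (f ∘ suc)

  sgn : ℕ → Carrier
  sgn zero    = 1#
  sgn (suc l) = - sgn l

  minor : Matrix → ℕ → Matrix
  minor A l i j = A (suc i) (punchIn l j)

  det′ : ℕ → Matrix → Carrier
  det′ zero    A = 1#
  det′ (suc n) A = ∑ (suc n) (λ l → sgn l * A 0 l * det′ n (minor A l))

  ∑-cong : ∀ n {f g} → (∀ l → l < n → f l ≈ g l) → ∑ n f ≈ ∑ n g
  ∑-cong zero    _   = refl
  ∑-cong (suc n) f≈g = +-cong (f≈g 0 (s≤s z≤n)) (∑-cong n λ l l<n → f≈g (suc l) (s≤s l<n))

  ∑-distrib-+ : ∀ n f g → ∑ n (λ l → f l + g l) ≈ ∑ n f + ∑ n g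
  ∑-distrib-+ zero    f g = sym (+-identityˡ 0#)
  ∑-distrib-+ (suc n) f g = trans (+-congˡ (∑-distrib-+ n (f ∘ suc) (g ∘ suc)))
    (solve 4 (λ a b x y → (a :+ b) :+ (x :+ y) := (a :+ x) :+ (b :+ y)) refl (f 0) (g 0) _ _)

  ∑-distribˡ : ∀ n x f → ∑ n (λ l → x * f l) ≈ x * ∑ n f
  ∑-distribˡ zero    x f = sym (zeroʳ x)
  ∑-distribˡ (suc n) x f = trans (+-congˡ (∑-distribˡ n x (f ∘ suc))) (sym (distribˡ x _ _))

  ∑-zero : ∀ n {f} → (∀ l → l < n → f l ≈ 0#) → ∑ n f ≈ 0#
  ∑-zero zero    _    = refl
  ∑-zero (suc n) f≈0 =
    trans (+-cong (f≈0 0 (s≤s z≤n)) (∑-zero n λ l l<n → f≈0 (suc l) (s≤s l<n))) (+-identityˡ 0#)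

  ∑-cancel-adjacent : ∀ n p {f} → suc p < n →
    (∀ l → l < n → l ≢ p → l ≢ suc p → f l ≈ 0#) → f p + f (suc p) ≈ 0# → ∑ n f ≈ 0#
  ∑-cancel-adjacent (suc (suc n)) zero {f} _ f≈0 pair = begin
    f 0 + (f 1 + ∑ n (f ∘ suc ∘ suc))
      ≈⟨ +-congˡ (+-congˡ (∑-zero n λ l l<n → f≈0 (2 ℕ.+ l) (s≤s (s≤s l<n)) (λ ()) (λ ()))) ⟩
    f 0 + (f 1 + 0#)
      ≈⟨ +-congˡ (+-identityʳ _) ⟩
    f 0 + f 1
      ≈⟨ pair ⟩
    0#                                ∎
  ∑-cancel-adjacent (suc n) (suc p) {f} (s≤s p+1<n) f≈0 pair =
    trans (+-cong (f≈0 0 (s≤s z≤n) (λ ()) (λ ()))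
                  (∑-cancel-adjacent n p p+1<n (λ l l<n l≢p l≢1+p →
                     f≈0 (suc l) (s≤s l<n) (l≢p ∘ ℕₚ.suc-injective) (l≢1+p ∘ ℕₚ.suc-injective)) pair))
          (+-identityˡ 0#)

  ∏-punchIn : ∀ n {l} γ → l < suc n → ∏ (suc n) γ ≈ γ l * ∏ n (γ ∘ punchIn l)
  ∏-punchIn n       {zero}  γ _ = refl
  ∏-punchIn (suc n) {suc l} γ (s≤s l<1+n) = begin
    γ 0 * ∏ (suc n) (γ ∘ suc)                       ≈⟨ *-congˡ (∏-punchIn n (γ ∘ suc) l<1+n) ⟩
    γ 0 * (γ (suc l) * ∏ n (γ ∘ suc ∘ punchIn l))   ≈⟨ solve 3 (λ a b x → a :* (b :* x) := b :* (a :* x)) refl _ _ _ ⟩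
    γ (suc l) * (γ 0 * ∏ n (γ ∘ suc ∘ punchIn l))   ∎

  ∏-cong : ∀ n {f g} → (∀ l → l < n → f l ≈ g l) → ∏ n f ≈ ∏ n g
  ∏-cong zero    _   = refl
  ∏-cong (suc n) f≈g = *-cong (f≈g 0 (s≤s z≤n)) (∏-cong n λ l l<n → f≈g (suc l) (s≤s l<n))

  ∏-distrib-* : ∀ n f g → ∏ n (λ l → f l * g l) ≈ ∏ n f * ∏ n g
  ∏-distrib-* zero    f g = sym (*-identityˡ 1#)
  ∏-distrib-* (suc n) f g = trans (*-congˡ (∏-distrib-* n (f ∘ suc) (g ∘ suc)))
    (solve 4 (λ a b x y → (a :* b) :* (x :* y) := (a :* x) :* (b :* y)) refl (f 0) (g 0) _ _)

  det′-cong : ∀ n {A B} → (∀ i j → i < n → j < n → A i j ≈ B i j) → det′ n A ≈ det′ n B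
  det′-cong zero    _   = refl
  det′-cong (suc n) A≈B = ∑-cong (suc n) λ l l<1+n →
    *-cong (*-congˡ {sgn l} (A≈B 0 l (s≤s z≤n) l<1+n))
           (det′-cong n λ i j i<n j<n → A≈B (suc i) _ (s≤s i<n) (punchIn-mono-< l j<n))

  det′-linear-column : ∀ n {A B B′ col} κ → col < n →
    (∀ i j → j ≢ col → A i j ≈ B i j) → (∀ i j → j ≢ col → A i j ≈ B′ i j) →
    (∀ i → A i col ≈ B i col + κ * B′ i col) → det′ n A ≈ det′ n B + κ * det′ n B′
  det′-linear-column (suc n) {A} {B} {B′} {col} κ col<1+n A≈B A≈B′ A≈B+κB′ = begin
    det′ (suc n) A                                  ≈⟨ ∑-cong (suc n) expand ⟩
    ∑ (suc n) (λ l → term B l + κ * term B′ l)        ≈⟨ ∑-distrib-+ (suc n) (term B) (λ l → κ * term B′ l) ⟩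
    det′ (suc n) B + ∑ (suc n) (λ l → κ * term B′ l) ≈⟨ +-congˡ (∑-distribˡ (suc n) κ (term B′)) ⟩
    det′ (suc n) B + κ * det′ (suc n) B′             ∎
    where
    term : Matrix → ℕ → Carrier
    term M l = sgn l * M 0 l * det′ n (minor M l)

    expand : ∀ l → l < suc n → term A l ≈ term B l + κ * term B′ l
    expand l l<1+n with l ℕ.≟ col
    ... | yes ≡.refl = begin
      sgn l * A 0 l * det′ n (minor A l)
        ≈⟨ *-cong (*-congˡ (A≈B+κB′ 0)) (det′-cong n λ i j _ _ → A≈B (suc i) _ (punchInᵢ≢i l j)) ⟩
      sgn l * (B 0 l + κ * B′ 0 l) * det′ n (minor B l)
        ≈⟨ solve 5 (λ s b x y d → s :* (b :+ x :* y) :* d := s :* b :* d :+ x :* (s :* y :* d)) refl _ _ κ _ _ ⟩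
      term B l + κ * (sgn l * B′ 0 l * det′ n (minor B l))
        ≈⟨ +-congˡ (*-congˡ (*-congˡ minorB≈minorB′)) ⟩
      term B l + κ * term B′ l                           ∎
      where
      minorB≈minorB′ : det′ n (minor B l) ≈ det′ n (minor B′ l)
      minorB≈minorB′ = det′-cong n λ i j _ _ →
        trans (sym (A≈B (suc i) _ (punchInᵢ≢i l j))) (A≈B′ (suc i) _ (punchInᵢ≢i l j))
    ... | no l≢col = begin
      sgn l * A 0 l * det′ n (minor A l)
        ≈⟨ *-congˡ minor-linear ⟩
      sgn l * A 0 l * (det′ n (minor B l) + κ * det′ n (minor B′ l))
        ≈⟨ solve 5 (λ s a x b y → s :* a :* (b :+ x :* y) := s :* a :* b :+ x :* (s :* a :* y)) refl _ _ κ _ _ ⟩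
      sgn l * A 0 l * det′ n (minor B l) + κ * (sgn l * A 0 l * det′ n (minor B′ l))
        ≈⟨ +-cong (*-congʳ (*-congˡ (A≈B 0 l l≢col))) (*-congˡ (*-congʳ (*-congˡ (A≈B′ 0 l l≢col)))) ⟩
      term B l + κ * term B′ l                                   ∎
      where
      q = punchOut l col
      punchIn-q : punchIn l q ≡ col
      punchIn-q = punchIn-punchOut (l≢col ∘ ≡.sym)
      j≢q⇒punchIn≢col : ∀ {j} → j ≢ q → punchIn l j ≢ col
      j≢q⇒punchIn≢col j≢q eq = j≢q (punchIn-injective l (≡.trans eq (≡.sym punchIn-q)))
      minor-linear : det′ n (minor A l) ≈ det′ n (minor B l) + κ * det′ n (minor B′ l)
      minor-linear = det′-linear-column n κ
        (punchIn-cancel-< l<1+n (≡.subst (_< suc n) (≡.sym punchIn-q) col<1+n))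
        (λ i j j≢q → A≈B (suc i) _ (j≢q⇒punchIn≢col j≢q))
        (λ i j j≢q → A≈B′ (suc i) _ (j≢q⇒punchIn≢col j≢q))
        (λ i → ≡.subst (λ k → A (suc i) k ≈ B (suc i) k + κ * B′ (suc i) k) (≡.sym punchIn-q) (A≈B+κB′ (suc i)))

  punchIn-adjacent-≈ : ∀ (f : ℕ → Carrier) p → f p ≈ f (suc p) → ∀ b → f (punchIn p b) ≈ f (punchIn (suc p) b)
  punchIn-adjacent-≈ f zero    fₚ≈fₚ₊₁ zero    = sym fₚ≈fₚ₊₁
  punchIn-adjacent-≈ f zero    _       (suc b) = refl
  punchIn-adjacent-≈ f (suc p) _       zero    = refl
  punchIn-adjacent-≈ f (suc p) fₚ≈fₚ₊₁ (suc b) = punchIn-adjacent-≈ (f ∘ suc) p fₚ≈fₚ₊₁ b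

  det′-equal-adjacent-columns : ∀ n {A} p → suc p < n → (∀ i → A i p ≈ A i (suc p)) → det′ n A ≈ 0#
  det′-equal-adjacent-columns (suc n) {A} p p+1<1+n Aₚ≈Aₚ₊₁ =
    ∑-cancel-adjacent (suc n) p p+1<1+n vanishing cancelling
    where
    term : ℕ → Carrier
    term l = sgn l * A 0 l * det′ n (minor A l)

    vanishing : ∀ l → l < suc n → l ≢ p → l ≢ suc p → term l ≈ 0#
    vanishing l l<1+n l≢p l≢1+p with punchIn-adjacent l≢p l≢1+p
    ... | q , q↦p , q+1↦p+1 = ≈0⇒*≈0ʳ minor≈0
      where
      minor≈0 : det′ n (minor A l) ≈ 0#
      minor≈0 = det′-equal-adjacent-columns n q
        (punchIn-cancel-< l<1+n (≡.subst (_< suc n) (≡.sym q+1↦p+1) p+1<1+n))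
        (λ i → ≡.subst₂ (λ u v → A (suc i) u ≈ A (suc i) v) (≡.sym q↦p) (≡.sym q+1↦p+1) (Aₚ≈Aₚ₊₁ (suc i)))

    cancelling : term p + term (suc p) ≈ 0#
    cancelling = begin
      sgn p * A 0 p * D + - sgn p * A 0 (suc p) * det′ n (minor A (suc p))
        ≈⟨ +-congˡ (*-cong (*-congˡ (sym (Aₚ≈Aₚ₊₁ 0)))
                           (det′-cong n λ i j _ _ → sym (punchIn-adjacent-≈ (A (suc i)) p (Aₚ≈Aₚ₊₁ (suc i)) j))) ⟩
      sgn p * A 0 p * D + - sgn p * A 0 p * D
        ≈⟨ solve 3 (λ s a d → s :* a :* d :+ :- s :* a :* d := con (+ 0)) refl _ _ _ ⟩
      0#                                      ∎
      where D = det′ n (minor A p)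

  copyColumn : Matrix → ℕ → ℕ → Matrix
  copyColumn A p q i j with j ℕ.≟ q
  ... | yes _ = A i p
  ... | no  _ = A i j

  copyColumn-≡ : ∀ A p q i → copyColumn A p q i q ≈ A i p
  copyColumn-≡ A p q i with q ℕ.≟ q
  ... | yes _   = refl
  ... | no  q≢q = ⊥-elim (q≢q ≡.refl)

  copyColumn-≢ : ∀ A p q i {j} → j ≢ q → copyColumn A p q i j ≈ A i j
  copyColumn-≢ A p q i {j} j≢q with j ℕ.≟ q
  ... | yes j≡q = ⊥-elim (j≢q j≡q)
  ... | no  _   = refl

  det′-add-previous-column : ∀ n {A B} p κ → suc p < n →
    (∀ i j → j ≢ suc p → B i j ≈ A i j) → (∀ i → B i (suc p) ≈ A i (suc p) + κ * A i p) →
    det′ n B ≈ det′ n A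
  det′-add-previous-column n {A} {B} p κ p+1<n B≈A B≈A+κA = begin
    det′ n B                  ≈⟨ det′-linear-column n κ p+1<n B≈A
                                   (λ i j j≢p+1 → trans (B≈A i j j≢p+1) (sym (copyColumn-≢ A p (suc p) i j≢p+1)))
                                   (λ i → trans (B≈A+κA i) (+-congˡ (*-congˡ (sym (copyColumn-≡ A p (suc p) i))))) ⟩
    det′ n A + κ * det′ n A′  ≈⟨ +-congˡ (*-congˡ (det′-equal-adjacent-columns n p p+1<n A′-repeats)) ⟩
    det′ n A + κ * 0#         ≈⟨ +-congˡ (zeroʳ κ) ⟩
    det′ n A + 0#             ≈⟨ +-identityʳ _ ⟩
    det′ n A                  ∎
    where
    A′ = copyColumn A p (suc p)
    A′-repeats : ∀ i → A′ i p ≈ A′ i (suc p)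
    A′-repeats i = trans (copyColumn-≢ A p (suc p) i (ℕₚ.<⇒≢ (ℕₚ.n<1+n p))) (sym (copyColumn-≡ A p (suc p) i))

  sweep : Matrix → (ℕ → Carrier) → Matrix
  sweep A κ i zero    = A i zero
  sweep A κ i (suc j) = A i (suc j) + κ (suc j) * A i j

  -- sweepFrom r does the column operations of sweep only on the columns ≥ r.  Going from
  -- r + 1 to r adds a multiple of column r - 1, which is still untouched, to column r.
  sweepFrom : ℕ → Matrix → (ℕ → Carrier) → Matrix
  sweepFrom r A κ i j with r ℕ.≤? j
  ... | yes _ = sweep A κ i j
  ... | no  _ = A i j

  sweepFrom-≥ : ∀ r A κ i j → r ≤ j → sweepFrom r A κ i j ≈ sweep A κ i j
  sweepFrom-≥ r A κ i j r≤j with r ℕ.≤? j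
  ... | yes _   = refl
  ... | no  r≰j = ⊥-elim (r≰j r≤j)

  sweepFrom-< : ∀ r A κ i {j} → j < r → sweepFrom r A κ i j ≈ A i j
  sweepFrom-< r A κ i {j} j<r with r ℕ.≤? j
  ... | yes r≤j = ⊥-elim (ℕₚ.<⇒≱ j<r r≤j)
  ... | no  _   = refl

  det′-sweepFrom-step : ∀ n A κ r → r < n → det′ n (sweepFrom r A κ) ≈ det′ n (sweepFrom (suc r) A κ)
  det′-sweepFrom-step n A κ zero _ = det′-cong n λ i j _ _ → same i j
    where
    same : ∀ i j → sweepFrom 0 A κ i j ≈ sweepFrom 1 A κ i j
    same i zero    = trans (sweepFrom-≥ 0 A κ i 0 z≤n) (sym (sweepFrom-< 1 A κ i (s≤s z≤n)))
    same i (suc j) = trans (sweepFrom-≥ 0 A κ i (suc j) z≤n) (sym (sweepFrom-≥ 1 A κ i (suc j) (s≤s z≤n)))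
  det′-sweepFrom-step n A κ (suc p) p+1<n =
    det′-add-previous-column n p (κ (suc p)) p+1<n off-column on-column
    where
    off-column : ∀ i j → j ≢ suc p → sweepFrom (suc p) A κ i j ≈ sweepFrom (suc (suc p)) A κ i j
    off-column i j j≢p+1 with ℕₚ.<-cmp j (suc p)
    ... | tri< j<p+1 _ _ = trans (sweepFrom-< (suc p) A κ i j<p+1) (sym (sweepFrom-< (2 ℕ.+ p) A κ i (ℕₚ.m<n⇒m<1+n j<p+1)))
    ... | tri≈ _ j≡p+1 _ = ⊥-elim (j≢p+1 j≡p+1)
    ... | tri> _ _ p+1<j = trans (sweepFrom-≥ (suc p) A κ i j (ℕₚ.<⇒≤ p+1<j)) (sym (sweepFrom-≥ (2 ℕ.+ p) A κ i j p+1<j))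
    on-column : ∀ i → sweepFrom (suc p) A κ i (suc p)
                    ≈ sweepFrom (suc (suc p)) A κ i (suc p) + κ (suc p) * sweepFrom (suc (suc p)) A κ i p
    on-column i = trans (sweepFrom-≥ (suc p) A κ i (suc p) ℕₚ.≤-refl)
      (sym (+-cong (sweepFrom-< (2 ℕ.+ p) A κ i (ℕₚ.n<1+n (suc p)))
                   (*-congˡ (sweepFrom-< (2 ℕ.+ p) A κ i (ℕₚ.m<n⇒m<1+n (ℕₚ.n<1+n p))))))

  det′-sweepFrom : ∀ n A κ m → m ≤ n → det′ n (sweepFrom (n ∸ m) A κ) ≈ det′ n A
  det′-sweepFrom n A κ zero _ = det′-cong n λ i j _ j<n → sweepFrom-< n A κ i j<n
  det′-sweepFrom n A κ (suc m) m<n = begin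
    det′ n (sweepFrom (n ∸ suc m) A κ)       ≈⟨ det′-sweepFrom-step n A κ (n ∸ suc m) (ℕₚ.∸-monoʳ-< (s≤s z≤n) m<n) ⟩
    det′ n (sweepFrom (suc (n ∸ suc m)) A κ) ≡⟨ ≡.cong (λ r → det′ n (sweepFrom r A κ)) (≡.sym (ℕₚ.+-∸-assoc 1 m<n)) ⟩
    det′ n (sweepFrom (n ∸ m) A κ)           ≈⟨ det′-sweepFrom n A κ m (ℕₚ.<⇒≤ m<n) ⟩
    det′ n A                                 ∎

  det′-sweep : ∀ n A κ → det′ n (sweep A κ) ≈ det′ n A
  det′-sweep n A κ = begin
    det′ n (sweep A κ)               ≈⟨ det′-cong n (λ i j _ _ → sym (sweepFrom-≥ 0 A κ i j z≤n)) ⟩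
    det′ n (sweepFrom 0 A κ)         ≡⟨ ≡.cong (λ r → det′ n (sweepFrom r A κ)) (≡.sym (ℕₚ.n∸n≡0 n)) ⟩
    det′ n (sweepFrom (n ∸ n) A κ)   ≈⟨ det′-sweepFrom n A κ n ℕₚ.≤-refl ⟩
    det′ n A                         ∎

  det′-firstRow-pivot : ∀ n A → (∀ j → j < n → A 0 (suc j) ≈ 0#) → det′ (suc n) A ≈ A 0 0 * det′ n (minor A 0)
  det′-firstRow-pivot n A row₀≈0 = begin
    1# * A 0 0 * det′ n (minor A 0) + ∑ n (λ l → sgn (suc l) * A 0 (suc l) * det′ n (minor A (suc l)))
      ≈⟨ +-cong (*-congʳ (*-identityˡ _)) (∑-zero n λ l l<n → ≈0⇒*≈0ˡ (≈0⇒*≈0ʳ (row₀≈0 l l<n))) ⟩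
    A 0 0 * det′ n (minor A 0) + 0# ≈⟨ +-identityʳ _ ⟩
    A 0 0 * det′ n (minor A 0)      ∎

  det′-scale-rows : ∀ n ρ A → det′ n (λ i j → ρ i * A i j) ≈ ∏ n ρ * det′ n A
  det′-scale-rows zero    ρ A = sym (*-identityʳ 1#)
  det′-scale-rows (suc n) ρ A =
    trans (∑-cong (suc n) λ l _ → scaled l) (∑-distribˡ (suc n) (∏ (suc n) ρ) λ l → sgn l * A 0 l * det′ n (minor A l))
    where
    scaled : ∀ l → sgn l * (ρ 0 * A 0 l) * det′ n (λ i j → ρ (suc i) * minor A l i j)
                 ≈ ∏ (suc n) ρ * (sgn l * A 0 l * det′ n (minor A l))
    scaled l = trans (*-congˡ (det′-scale-rows n (ρ ∘ suc) (minor A l)))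
      (solve 5 (λ s r a p d → s :* (r :* a) :* (p :* d) := (r :* p) :* (s :* a :* d)) refl _ _ _ _ _)

  det′-scale-columns : ∀ n γ A → det′ n (λ i j → A i j * γ j) ≈ ∏ n γ * det′ n A
  det′-scale-columns zero    γ A = sym (*-identityʳ 1#)
  det′-scale-columns (suc n) γ A =
    trans (∑-cong (suc n) scaled) (∑-distribˡ (suc n) (∏ (suc n) γ) λ l → sgn l * A 0 l * det′ n (minor A l))
    where
    scaled : ∀ l → l < suc n → sgn l * (A 0 l * γ l) * det′ n (λ i j → minor A l i j * γ (punchIn l j))
                             ≈ ∏ (suc n) γ * (sgn l * A 0 l * det′ n (minor A l))
    scaled l l<1+n = begin
      sgn l * (A 0 l * γ l) * det′ n (λ i j → minor A l i j * γ (punchIn l j))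
        ≈⟨ *-congˡ (det′-scale-columns n (γ ∘ punchIn l) (minor A l)) ⟩
      sgn l * (A 0 l * γ l) * (∏ n (γ ∘ punchIn l) * det′ n (minor A l))
        ≈⟨ solve 5 (λ s a g p d → s :* (a :* g) :* (p :* d) := (g :* p) :* (s :* a :* d)) refl _ _ _ _ _ ⟩
      γ l * ∏ n (γ ∘ punchIn l) * (sgn l * A 0 l * det′ n (minor A l))
        ≈⟨ *-congʳ (sym (∏-punchIn n γ l<1+n)) ⟩
      ∏ (suc n) γ * (sgn l * A 0 l * det′ n (minor A l)) ∎

  Staircase : ℕ → (ℕ → ℕ) → (ℕ → ℕ) → Matrix → Set ℓ
  Staircase n r c Y = ∀ i j → i < n → j < n → c j < r i → Y i j ≈ 0#

  staircase-minor : ∀ {n r c Y} l → l < suc n → Staircase (suc n) r c Y →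
    Staircase n (r ∘ suc) (c ∘ punchIn l) (minor Y l)
  staircase-minor l l<1+n st i j i<n j<n = st (suc i) (punchIn l j) (s≤s i<n) (punchIn-mono-< l j<n)

  det′-staircase-zero : ∀ n {r c Y} → Staircase n r c Y → ∑ℕ n c < ∑ℕ n r → det′ n Y ≈ 0#
  det′-staircase-zero (suc n) {r} {c} {Y} st ∑c<∑r = ∑-zero (suc n) vanishing
    where
    vanishing : ∀ l → l < suc n → sgn l * Y 0 l * det′ n (minor Y l) ≈ 0#
    vanishing l l<1+n with c l ℕ.<? r 0
    ... | yes cₗ<r₀ = ≈0⇒*≈0ˡ (≈0⇒*≈0ʳ (st 0 l (s≤s z≤n) l<1+n cₗ<r₀))
    ... | no  cₗ≮r₀ = ≈0⇒*≈0ʳ (det′-staircase-zero n (staircase-minor l l<1+n st) ∑c′<∑r′)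
      where
      ∑c′<∑r′ : ∑ℕ n (c ∘ punchIn l) < ∑ℕ n (r ∘ suc)
      ∑c′<∑r′ = +-cancel-<-≥ (≡.subst (_< ∑ℕ (suc n) r) (∑ℕ-punchIn n c l<1+n) ∑c<∑r) (ℕₚ.≮⇒≥ cₗ≮r₀)

  -- Where c j < r i the exponent c j ∸ r i is truncated, but there the entry of Y vanishes.
  det′-staircase-powers : ∀ n {r c Y} w → Staircase n r c Y →
    det′ n (λ i j → w ^ (c j ∸ r i) * Y i j) ≈ w ^ (∑ℕ n c ∸ ∑ℕ n r) * det′ n Y
  det′-staircase-powers zero    w st = sym (*-identityʳ 1#)
  det′-staircase-powers (suc n) {r} {c} {Y} w st =
    trans (∑-cong (suc n) factor) (∑-distribˡ (suc n) W λ l → sgn l * Y 0 l * det′ n (minor Y l))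
    where
    W = w ^ (∑ℕ (suc n) c ∸ ∑ℕ (suc n) r)
    Yʷ : Matrix
    Yʷ i j = w ^ (c j ∸ r i) * Y i j

    factor : ∀ l → l < suc n → sgn l * Yʷ 0 l * det′ n (minor Yʷ l) ≈ W * (sgn l * Y 0 l * det′ n (minor Y l))
    factor l l<1+n with c l ℕ.<? r 0 | ∑ℕ n (c ∘ punchIn l) ℕ.<? ∑ℕ n (r ∘ suc)
    ... | yes cₗ<r₀ | _ =
      trans (≈0⇒*≈0ˡ (≈0⇒*≈0ʳ (≈0⇒*≈0ʳ Y₀ₗ≈0))) (sym (≈0⇒*≈0ʳ (≈0⇒*≈0ˡ (≈0⇒*≈0ʳ Y₀ₗ≈0))))
      where Y₀ₗ≈0 = st 0 l (s≤s z≤n) l<1+n cₗ<r₀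
    ... | no _ | yes ∑c′<∑r′ =
      trans (≈0⇒*≈0ʳ (det′-staircase-zero n (λ i j i<n j<n lt → ≈0⇒*≈0ʳ (minor-st i j i<n j<n lt)) ∑c′<∑r′))
            (sym (≈0⇒*≈0ʳ (≈0⇒*≈0ʳ (det′-staircase-zero n minor-st ∑c′<∑r′))))
      where minor-st = staircase-minor l l<1+n st
    ... | no cₗ≮r₀ | no ∑c′≮∑r′ = begin
      sgn l * (w ^ (c l ∸ r 0) * Y 0 l) * det′ n (minor Yʷ l)
        ≈⟨ *-congˡ (det′-staircase-powers n w (staircase-minor l l<1+n st)) ⟩
      sgn l * (w ^ (c l ∸ r 0) * Y 0 l) * (w ^ (∑c′ ∸ ∑r′) * det′ n (minor Y l))
        ≈⟨ solve 5 (λ s p y q d → s :* (p :* y) :* (q :* d) := (p :* q) :* (s :* y :* d)) refl _ _ _ _ _ ⟩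
      (w ^ (c l ∸ r 0) * w ^ (∑c′ ∸ ∑r′)) * (sgn l * Y 0 l * det′ n (minor Y l))
        ≈⟨ *-congʳ (sym (^-homo-* w (c l ∸ r 0) (∑c′ ∸ ∑r′))) ⟩
      w ^ ((c l ∸ r 0) ℕ.+ (∑c′ ∸ ∑r′)) * (sgn l * Y 0 l * det′ n (minor Y l))
        ≡⟨ ≡.cong (λ e → w ^ e * (sgn l * Y 0 l * det′ n (minor Y l))) exponent ⟩
      W * (sgn l * Y 0 l * det′ n (minor Y l)) ∎
      where
      ∑c′ = ∑ℕ n (c ∘ punchIn l)
      ∑r′ = ∑ℕ n (r ∘ suc)
      exponent : (c l ∸ r 0) ℕ.+ (∑c′ ∸ ∑r′) ≡ ∑ℕ (suc n) c ∸ ∑ℕ (suc n) r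
      exponent = ≡.trans (+-∸-interchange (ℕₚ.≮⇒≥ cₗ≮r₀) (ℕₚ.≮⇒≥ ∑c′≮∑r′))
                         (≡.cong (_∸ ∑ℕ (suc n) r) (≡.sym (∑ℕ-punchIn n c l<1+n)))

module FieldProperties {c ℓ : Level} (K : Field c ℓ) where
  open Field K hiding (zero)
  open FieldDefs K using (pow; prod; _/_)
  open IntegerCoefficientSolver commutativeRing
  open Determinant commutativeRing using (∏; ∏-cong; ∏-distrib-*)
  open import Algebra.Properties.Semiring.Exp semiring using (_^_)
  open import Relation.Binary.Reasoning.Setoid setoid

  ⁻¹-inverseˡ : ∀ x → x ≉ 0# → x ⁻¹ * x ≈ 1#
  ⁻¹-inverseˡ x x≉0 = trans (*-comm _ _) (⁻¹-inverseʳ x x≉0)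

  *-cancelʳ : ∀ {x y} z → z ≉ 0# → x * z ≈ y * z → x ≈ y
  *-cancelʳ {x} {y} z z≉0 xz≈yz = begin
    x                ≈⟨ *-identityʳ x ⟨
    x * 1#           ≈⟨ *-congˡ (⁻¹-inverseʳ z z≉0) ⟨
    x * (z * z ⁻¹)   ≈⟨ *-assoc x z _ ⟨
    x * z * z ⁻¹     ≈⟨ *-congʳ xz≈yz ⟩
    y * z * z ⁻¹     ≈⟨ *-assoc y z _ ⟩
    y * (z * z ⁻¹)   ≈⟨ *-congˡ (⁻¹-inverseʳ z z≉0) ⟩
    y * 1#           ≈⟨ *-identityʳ y ⟩
    y                ∎

  *-≉0 : ∀ {x y} → x ≉ 0# → y ≉ 0# → x * y ≉ 0#
  *-≉0 {x} {y} x≉0 y≉0 xy≈0 = x≉0 (*-cancelʳ y y≉0 (trans xy≈0 (sym (zeroˡ y))))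

  ⁻¹-unique : ∀ {x y} → x ≉ 0# → x * y ≈ 1# → y ≈ x ⁻¹
  ⁻¹-unique {x} {y} x≉0 xy≈1 = *-cancelʳ x x≉0 (trans (*-comm y x) (trans xy≈1 (sym (⁻¹-inverseˡ x x≉0))))

  pow≈^ : ∀ x n → pow x n ≈ x ^ n
  pow≈^ x zero    = refl
  pow≈^ x (suc n) = trans (*-comm _ x) (*-congˡ (pow≈^ x n))

  ∏-snoc : ∀ k f → ∏ (suc k) f ≈ ∏ k f * f k
  ∏-snoc zero    f = *-comm _ _
  ∏-snoc (suc k) f = trans (*-congˡ (∏-snoc k (f ∘ suc))) (sym (*-assoc _ _ _))

  prod≈∏ : ∀ k f → prod k f ≈ ∏ k f
  prod≈∏ zero    f = refl
  prod≈∏ (suc k) f = trans (*-congʳ (prod≈∏ k f)) (sym (∏-snoc k f))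

  ∏-⁻¹ : ∀ k f → (∀ j → f j ≉ 0#) → ∏ k (λ j → f j ⁻¹) * ∏ k f ≈ 1#
  ∏-⁻¹ k f f≉0 = begin
    ∏ k (λ j → f j ⁻¹) * ∏ k f   ≈⟨ ∏-distrib-* k _ f ⟨
    ∏ k (λ j → f j ⁻¹ * f j)     ≈⟨ ∏-cong k (λ j _ → ⁻¹-inverseˡ (f j) (f≉0 j)) ⟩
    ∏ k (λ _ → 1#)               ≈⟨ ∏-1 k ⟩
    1#                           ∎
    where
    ∏-1 : ∀ k → ∏ k (λ _ → 1#) ≈ 1#
    ∏-1 zero    = refl
    ∏-1 (suc k) = trans (*-identityˡ _) (∏-1 k)

  /-*-cancel : ∀ x {y} → y ≉ 0# → x / y * y ≈ x
  /-*-cancel x {y} y≉0 = trans (*-assoc x _ y) (trans (*-congˡ (⁻¹-inverseˡ y y≉0)) (*-identityʳ x))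

  x+-[y/z]*u≈[x*z-y*u]/z : ∀ x y {z} u → z ≉ 0# → x + - (y / z) * u ≈ (x * z - y * u) / z
  x+-[y/z]*u≈[x*z-y*u]/z x y {z} u z≉0 = begin
    x + - (y * z ⁻¹) * u
      ≈⟨ +-congʳ (trans (*-congˡ (⁻¹-inverseʳ z z≉0)) (*-identityʳ x)) ⟨
    x * (z * z ⁻¹) + - (y * z ⁻¹) * u
      ≈⟨ solve 5 (λ x y z z′ u → x :* (z :* z′) :+ :- (y :* z′) :* u := (x :* z :+ :- (y :* u)) :* z′) refl x y z (z ⁻¹) u ⟩
    (x * z - y * u) * z ⁻¹            ∎

module FibonacciIdentities {c ℓ : Level} (K : Field c ℓ) (s t : Field.Carrier K) where
  open Field K hiding (zero)
  open FieldDefs K using (F)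
  open IntegerCoefficientSolver commutativeRing
  open import Algebra.Properties.Semiring.Exp semiring using (_^_)
  open import Relation.Binary.Reasoning.Setoid setoid

  Recurrent : (ℕ → Carrier) → Set ℓ
  Recurrent x = ∀ n → x (suc (suc n)) ≈ s * x (suc n) + t * x n

  recurrent-F : Recurrent (F s t)
  recurrent-F n = refl

  recurrent-shift : ∀ a {x} → Recurrent x → Recurrent (λ n → x (n ℕ.+ a))
  recurrent-shift a rec n = rec (n ℕ.+ a)

  recurrent-suc : ∀ {x} → Recurrent x → Recurrent (x ∘ suc)
  recurrent-suc rec n = rec (suc n)

  recurrent-scaleˡ : ∀ k {x} → Recurrent x → Recurrent (λ n → k * x n)
  recurrent-scaleˡ k {x} rec n = trans (*-congˡ (rec n))
    (solve 5 (λ k s t a b → k :* (s :* a :+ t :* b) := s :* (k :* a) :+ t :* (k :* b)) refl k s t (x (suc n)) (x n))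

  recurrent-scaleʳ : ∀ k {x} → Recurrent x → Recurrent (λ n → x n * k)
  recurrent-scaleʳ k {x} rec n = trans (*-congʳ (rec n))
    (solve 5 (λ k s t a b → (s :* a :+ t :* b) :* k := s :* (a :* k) :+ t :* (b :* k)) refl k s t (x (suc n)) (x n))

  recurrent-+ : ∀ {x y} → Recurrent x → Recurrent y → Recurrent (λ n → x n + y n)
  recurrent-+ {x} {y} recx recy n = trans (+-cong (recx n) (recy n))
    (solve 6 (λ s t a b a′ b′ → (s :* a :+ t :* b) :+ (s :* a′ :+ t :* b′) := s :* (a :+ a′) :+ t :* (b :+ b′))
           refl s t (x (suc n)) (x n) (y (suc n)) (y n))

  recurrent-unique : ∀ {x y} → Recurrent x → Recurrent y → x 0 ≈ y 0 → x 1 ≈ y 1 → ∀ n → x n ≈ y n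
  recurrent-unique {x} {y} recx recy x₀≈y₀ x₁≈y₁ n = proj₁ (agree n)
    where
    agree : ∀ n → x n ≈ y n × x (suc n) ≈ y (suc n)
    agree zero    = x₀≈y₀ , x₁≈y₁
    agree (suc n) with agree n
    ... | xₙ≈yₙ , xₙ₊₁≈yₙ₊₁ =
      xₙ₊₁≈yₙ₊₁ , trans (recx n) (trans (+-cong (*-congˡ xₙ₊₁≈yₙ₊₁) (*-congˡ xₙ≈yₙ)) (sym (recy n)))

  F-cassini : ∀ a → F s t (suc a) * F s t (suc a) ≈ F s t a * F s t (2 ℕ.+ a) + (- t) ^ a
  F-cassini zero = begin
    1# * 1#                       ≈⟨ *-identityˡ 1# ⟩
    1#                            ≈⟨ +-identityˡ 1# ⟨
    0# + 1#                       ≈⟨ +-congʳ (zeroˡ _) ⟨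
    0# * F s t 2 + 1#             ∎
  F-cassini (suc a) = begin
    F₂ * F₂
      ≈⟨ solve 4 (λ s t f₀ f₁ →
           (s :* f₁ :+ t :* f₀) :* (s :* f₁ :+ t :* f₀)
           := f₁ :* (s :* (s :* f₁ :+ t :* f₀) :+ t :* f₁) :+ (:- t) :* (f₁ :* f₁ :+ :- (f₀ :* (s :* f₁ :+ t :* f₀))))
           refl s t F₀ F₁ ⟩
    F₁ * F₃ + (- t) * (F₁ * F₁ - F₀ * F₂)
      ≈⟨ +-congˡ (*-congˡ (+-congʳ (F-cassini a))) ⟩
    F₁ * F₃ + (- t) * (F₀ * F₂ + (- t) ^ a - F₀ * F₂)
      ≈⟨ solve 4 (λ x y t p → x :+ (:- t) :* (y :+ p :+ :- y) := x :+ (:- t) :* p) refl (F₁ * F₃) (F₀ * F₂) t ((- t) ^ a) ⟩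
    F₁ * F₃ + (- t) ^ suc a ∎
    where
    F₀ = F s t a
    F₁ = F s t (suc a)
    F₂ = F s t (2 ℕ.+ a)
    F₃ = F s t (3 ℕ.+ a)

  F-dOcagne : ∀ a b → F s t (b ℕ.+ a) * F s t (suc a) ≈ F s t a * F s t (suc (b ℕ.+ a)) + (- t) ^ a * F s t b
  F-dOcagne a = recurrent-unique
    (recurrent-scaleʳ (F s t (suc a)) (recurrent-shift a recurrent-F))
    (recurrent-+ (recurrent-scaleˡ (F s t a) (recurrent-suc (recurrent-shift a recurrent-F)))
                 (recurrent-scaleˡ ((- t) ^ a) recurrent-F))
    (trans (sym (+-identityʳ _)) (+-congˡ (sym (zeroʳ _))))
    (trans (F-cassini a) (+-congˡ (sym (*-identityʳ _))))

  F-vajda : ∀ a b c → F s t (b ℕ.+ a) * F s t (c ℕ.+ a) ≈ F s t a * F s t (c ℕ.+ (b ℕ.+ a)) + (- t) ^ a * F s t b * F s t c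
  F-vajda a b = recurrent-unique
    (recurrent-scaleˡ (F s t (b ℕ.+ a)) (recurrent-shift a recurrent-F))
    (recurrent-+ (recurrent-scaleˡ (F s t a) (recurrent-shift (b ℕ.+ a) recurrent-F))
                 (recurrent-scaleˡ ((- t) ^ a * F s t b) recurrent-F))
    (trans (sym (+-identityʳ _)) (+-cong (*-comm _ _) (sym (zeroʳ _))))
    (trans (F-dOcagne a b) (+-congˡ (sym (*-identityʳ _))))

module Fibonomials {c ℓ : Level} (K : Field c ℓ) (s t : Field.Carrier K)
  (F≉0 : ∀ m → ¬ (Field._≈_ K (FieldDefs.F K s t (suc m)) (Field.0# K))) where
  open Field K hiding (zero)
  open FieldDefs K using (_/_; fibonomial)
  open IntegerCoefficientSolver commutativeRing
  open Determinant commutativeRing using (∏; ∏-cong; ∏-distrib-*; ≈0⇒*≈0ˡ; ≈0⇒*≈0ʳ)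
  open FieldProperties K
  open FibonacciIdentities K s t using (F-vajda)
  open import Algebra.Properties.Semiring.Exp semiring using (_^_; ^-congʳ)
  open import Algebra.Properties.Ring ring using (-0#≈0#)
  open import Relation.Binary.Reasoning.Setoid setoid

  F : ℕ → Carrier
  F = FieldDefs.F K s t

  F-cong : ∀ {i j} → i ≡ j → F i ≈ F j
  F-cong i≡j = reflexive (≡.cong F i≡j)

  F! : ℕ → Carrier
  F! zero    = 1#
  F! (suc m) = F! m * F (suc m)

  F!≉0 : ∀ m → F! m ≉ 0#
  F!≉0 zero    0≈1 = 0≉1 (sym 0≈1)
  F!≉0 (suc m) = *-≉0 (F!≉0 m) (F≉0 m)

  F-∸≉0 : ∀ {k j} → j < k → F (k ∸ j) ≉ 0#
  F-∸≉0 {suc k} {j} (s≤s j≤k) = ≡.subst (λ i → F i ≉ 0#) (≡.sym (ℕₚ.+-∸-assoc 1 j≤k)) (F≉0 (k ∸ j))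

  fibonomial-cong : ∀ {m m′} k → m ≡ m′ → fibonomial s t m k ≈ fibonomial s t m′ k
  fibonomial-cong k m≡m′ = reflexive (≡.cong (λ m → fibonomial s t m k) m≡m′)

  fibonomial-≤ : ∀ {m k} → k ≤ m → fibonomial s t m k ≈ ∏ k (λ j → F (m ∸ j) / F (k ∸ j))
  fibonomial-≤ {m} {k} k≤m with k ℕ.≤? m
  ... | yes _   = prod≈∏ k _
  ... | no  k≰m = ⊥-elim (k≰m k≤m)

  fibonomial-> : ∀ {m k} → m < k → fibonomial s t m k ≈ 0#
  fibonomial-> {m} {k} m<k with k ℕ.≤? m
  ... | yes k≤m = ⊥-elim (ℕₚ.<⇒≱ m<k k≤m)
  ... | no  _   = refl

  ∏-F-falling : ∀ {m k} → k ≤ m → ∏ k (λ j → F (m ∸ j)) * F! (m ∸ k) ≈ F! m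
  ∏-F-falling {m}     {zero}  _         = *-identityˡ (F! m)
  ∏-F-falling {suc m} {suc k} (s≤s k≤m) = begin
    F (suc m) * ∏ k (λ j → F (m ∸ j)) * F! (m ∸ k)   ≈⟨ *-assoc _ _ _ ⟩
    F (suc m) * (∏ k (λ j → F (m ∸ j)) * F! (m ∸ k)) ≈⟨ *-congˡ (∏-F-falling k≤m) ⟩
    F (suc m) * F! m                                 ≈⟨ *-comm _ _ ⟩
    F! (suc m)                                       ∎

  F!≈∏ : ∀ k → F! k ≈ ∏ k (λ j → F (k ∸ j))
  F!≈∏ k = begin
    F! k                                      ≈⟨ ∏-F-falling (ℕₚ.≤-refl {k}) ⟨
    ∏ k (λ j → F (k ∸ j)) * F! (k ∸ k)        ≡⟨ ≡.cong (λ i → ∏ k (λ j → F (k ∸ j)) * F! i) (ℕₚ.n∸n≡0 k) ⟩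
    ∏ k (λ j → F (k ∸ j)) * 1#                ≈⟨ *-identityʳ _ ⟩
    ∏ k (λ j → F (k ∸ j))                     ∎

  fibonomial-F! : ∀ {m k} → k ≤ m → fibonomial s t m k * F! k * F! (m ∸ k) ≈ F! m
  fibonomial-F! {m} {k} k≤m = begin
    fibonomial s t m k * F! k * F! (m ∸ k)
      ≈⟨ *-congʳ (*-cong (fibonomial-≤ k≤m) (F!≈∏ k)) ⟩
    ∏ k (λ j → F (m ∸ j) / F (k ∸ j)) * ∏ k (λ j → F (k ∸ j)) * F! (m ∸ k)
      ≈⟨ *-congʳ (∏-distrib-* k _ _) ⟨
    ∏ k (λ j → F (m ∸ j) / F (k ∸ j) * F (k ∸ j)) * F! (m ∸ k)
      ≈⟨ *-congʳ (∏-cong k λ j j<k → /-*-cancel _ (F-∸≉0 j<k)) ⟩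
    ∏ k (λ j → F (m ∸ j)) * F! (m ∸ k)
      ≈⟨ ∏-F-falling k≤m ⟩
    F! m ∎

  fibonomial-F!-+ : ∀ k e → fibonomial s t (k ℕ.+ e) k * F! k * F! e ≈ F! (k ℕ.+ e)
  fibonomial-F!-+ k e = ≡.subst (λ i → fibonomial s t (k ℕ.+ e) k * F! k * F! i ≈ F! (k ℕ.+ e))
    (ℕₚ.m+n∸m≡n k e) (fibonomial-F! (ℕₚ.m≤m+n k e))

  cancel-F! : ∀ k e {x y} → x * (F! k * F! e) ≈ y * (F! k * F! e) → x ≈ y
  cancel-F! k e = *-cancelʳ (F! k * F! e) (*-≉0 (F!≉0 k) (F!≉0 e))

  fibonomial-diagonal : ∀ k → fibonomial s t k k ≈ 1#
  fibonomial-diagonal k = cancel-F! k 0 (begin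
    fibonomial s t k k * (F! k * 1#)     ≈⟨ *-assoc _ _ _ ⟨
    fibonomial s t k k * F! k * F! 0     ≡⟨ ≡.cong (λ i → fibonomial s t k k * F! k * F! i) (ℕₚ.n∸n≡0 k) ⟨
    fibonomial s t k k * F! k * F! (k ∸ k) ≈⟨ fibonomial-F! (ℕₚ.≤-refl {k}) ⟩
    F! k                                 ≈⟨ *-identityʳ _ ⟨
    F! k * 1#                            ≈⟨ *-identityˡ _ ⟨
    1# * (F! k * 1#)                     ∎)

  fibonomial-symmetric : ∀ k e → fibonomial s t (k ℕ.+ e) k ≈ fibonomial s t (k ℕ.+ e) e
  fibonomial-symmetric k e = cancel-F! k e (begin
    fibonomial s t (k ℕ.+ e) k * (F! k * F! e)  ≈⟨ *-assoc _ _ _ ⟨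
    fibonomial s t (k ℕ.+ e) k * F! k * F! e    ≈⟨ fibonomial-F!-+ k e ⟩
    F! (k ℕ.+ e)                                ≈⟨ fibonomial-F! (ℕₚ.m≤n+m e k) ⟨
    fibonomial s t (k ℕ.+ e) e * F! e * F! (k ℕ.+ e ∸ e)
      ≡⟨ ≡.cong (λ i → fibonomial s t (k ℕ.+ e) e * F! e * F! i) (ℕₚ.m+n∸n≡m k e) ⟩
    fibonomial s t (k ℕ.+ e) e * F! e * F! k    ≈⟨ solve 3 (λ x a b → x :* a :* b := x :* (b :* a)) refl _ _ _ ⟩
    fibonomial s t (k ℕ.+ e) e * (F! k * F! e)  ∎)

  fibonomial-absorption : ∀ k e →
    fibonomial s t (suc k ℕ.+ e) (suc k) * F (suc k) ≈ F (suc k ℕ.+ e) * fibonomial s t (k ℕ.+ e) k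
  fibonomial-absorption k e = cancel-F! k e (begin
    fibonomial s t (suc k ℕ.+ e) (suc k) * F (suc k) * (F! k * F! e)
      ≈⟨ solve 4 (λ x f a b → x :* f :* (a :* b) := x :* (a :* f) :* b) refl _ _ _ _ ⟩
    fibonomial s t (suc k ℕ.+ e) (suc k) * F! (suc k) * F! e   ≈⟨ fibonomial-F!-+ (suc k) e ⟩
    F! (k ℕ.+ e) * F (suc k ℕ.+ e)                              ≈⟨ *-congʳ (fibonomial-F!-+ k e) ⟨
    fibonomial s t (k ℕ.+ e) k * F! k * F! e * F (suc k ℕ.+ e)
      ≈⟨ solve 4 (λ x a b f → x :* a :* b :* f := f :* x :* (a :* b)) refl _ _ _ _ ⟩
    F (suc k ℕ.+ e) * fibonomial s t (k ℕ.+ e) k * (F! k * F! e) ∎)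

  fibonomial-absorption-complement : ∀ k e →
    fibonomial s t (k ℕ.+ suc e) k * F (suc e) ≈ F (k ℕ.+ suc e) * fibonomial s t (k ℕ.+ e) k
  fibonomial-absorption-complement k e = cancel-F! k e (begin
    fibonomial s t (k ℕ.+ suc e) k * F (suc e) * (F! k * F! e)
      ≈⟨ solve 4 (λ x f a b → x :* f :* (a :* b) := x :* a :* (b :* f)) refl _ _ _ _ ⟩
    fibonomial s t (k ℕ.+ suc e) k * F! k * F! (suc e)
      ≈⟨ fibonomial-F!-+ k (suc e) ⟩
    F! (k ℕ.+ suc e)
      ≡⟨ ≡.cong F! (ℕₚ.+-suc k e) ⟩
    F! (k ℕ.+ e) * F (suc (k ℕ.+ e))
      ≈⟨ *-cong (fibonomial-F!-+ k e) (F-cong (ℕₚ.+-suc k e)) ⟨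
    fibonomial s t (k ℕ.+ e) k * F! k * F! e * F (k ℕ.+ suc e)
      ≈⟨ solve 4 (λ x a b f → x :* a :* b :* f := f :* x :* (a :* b)) refl _ _ _ _ ⟩
    F (k ℕ.+ suc e) * fibonomial s t (k ℕ.+ e) k * (F! k * F! e) ∎)

  fibonomial-lower-step : ∀ k e → fibonomial s t (suc k ℕ.+ e) (suc k) * F (suc k) ≈ F (suc e) * fibonomial s t (k ℕ.+ suc e) k
  fibonomial-lower-step k e = cancel-F! k e (begin
    fibonomial s t (suc k ℕ.+ e) (suc k) * F (suc k) * (F! k * F! e)
      ≈⟨ solve 4 (λ x f a b → x :* f :* (a :* b) := x :* (a :* f) :* b) refl _ _ _ _ ⟩
    fibonomial s t (suc k ℕ.+ e) (suc k) * F! (suc k) * F! e   ≈⟨ fibonomial-F!-+ (suc k) e ⟩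
    F! (suc k ℕ.+ e)                                            ≡⟨ ≡.cong F! (ℕₚ.+-suc k e) ⟨
    F! (k ℕ.+ suc e)                                            ≈⟨ fibonomial-F!-+ k (suc e) ⟨
    fibonomial s t (k ℕ.+ suc e) k * F! k * (F! e * F (suc e))
      ≈⟨ solve 4 (λ x a b f → x :* a :* (b :* f) := f :* x :* (a :* b)) refl _ _ _ _ ⟩
    F (suc e) * fibonomial s t (k ℕ.+ suc e) k * (F! k * F! e) ∎)

  Contiguity : ℕ → ℕ → ℕ → Set ℓ
  Contiguity k a D =
    fibonomial s t (suc k ℕ.+ D ∸ a) (suc k) * F (suc D) - F (suc k ℕ.+ suc D) * fibonomial s t (suc k ℕ.+ D ∸ suc a) (suc k)
      ≈ F (suc a) * ((- t) ^ (D ∸ a) * fibonomial s t (k ℕ.+ D ∸ a) k)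

  contiguity-core : ∀ k a e →
    fibonomial s t (suc k ℕ.+ suc e) (suc k) * F (suc a ℕ.+ suc e) - F (suc a ℕ.+ (suc k ℕ.+ suc e)) * fibonomial s t (suc k ℕ.+ e) (suc k)
      ≈ F (suc a) * ((- t) ^ suc e * fibonomial s t (k ℕ.+ suc e) k)
  contiguity-core k a e = *-cancelʳ (F (suc k)) (F≉0 k) (begin
    (A * Fa′ - B * A′) * Fk
      ≈⟨ solve 5 (λ a f b c g → (a :* f :+ :- (b :* c)) :* g := a :* g :* f :+ :- (b :* (c :* g))) refl A Fa′ B A′ Fk ⟩
    A * Fk * Fa′ - B * (A′ * Fk)
      ≈⟨ +-cong (*-congʳ (fibonomial-absorption k (suc e))) (-‿cong (*-congˡ (fibonomial-lower-step k e))) ⟩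
    X * Z * Fa′ - B * (F (suc e) * Z)
      ≈⟨ solve 5 (λ x z f b g → x :* z :* f :+ :- (b :* (g :* z)) := z :* (x :* f :+ :- (g :* b))) refl X Z Fa′ B (F (suc e)) ⟩
    Z * (X * Fa′ - F (suc e) * B)
      ≈⟨ *-congˡ (+-congʳ (F-vajda (suc e) (suc k) (suc a))) ⟩
    Z * (F (suc e) * B + W * Fk * F (suc a) - F (suc e) * B)
      ≈⟨ solve 5 (λ z y w g f → z :* (y :+ w :* g :* f :+ :- y) := f :* (w :* z) :* g) refl Z (F (suc e) * B) W Fk (F (suc a)) ⟩
    F (suc a) * (W * Z) * Fk                 ∎)
    where
    A  = fibonomial s t (suc k ℕ.+ suc e) (suc k)
    A′  = fibonomial s t (suc k ℕ.+ e) (suc k)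
    Z  = fibonomial s t (k ℕ.+ suc e) k
    B  = F (suc a ℕ.+ (suc k ℕ.+ suc e))
    X  = F (suc k ℕ.+ suc e)
    Fa′ = F (suc a ℕ.+ suc e)
    Fk = F (suc k)
    W  = (- t) ^ suc e

  contiguity-gap : ∀ k a e → Contiguity k a (a ℕ.+ suc e)
  contiguity-gap k a e = begin
    fibonomial s t (suc k ℕ.+ D ∸ a) (suc k) * F (suc D) - F (suc k ℕ.+ suc D) * fibonomial s t (suc k ℕ.+ D ∸ suc a) (suc k)
      ≡⟨ ≡.cong₂ (λ x y → fibonomial s t x (suc k) * F (suc D) - F y * fibonomial s t (suc k ℕ.+ D ∸ suc a) (suc k))
                 (m+[n+o]∸n≡m+o (suc k) a (suc e)) (1+m+1+[n+1+o]≡1+n+[1+m+1+o] k a e) ⟩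
    fibonomial s t (suc k ℕ.+ suc e) (suc k) * F (suc D) - F (suc a ℕ.+ (suc k ℕ.+ suc e)) * fibonomial s t (suc k ℕ.+ D ∸ suc a) (suc k)
      ≡⟨ ≡.cong (λ x → fibonomial s t (suc k ℕ.+ suc e) (suc k) * F (suc D) - F (suc a ℕ.+ (suc k ℕ.+ suc e)) * fibonomial s t x (suc k))
                (≡.trans (≡.cong (λ x → suc k ℕ.+ x ∸ suc a) (ℕₚ.+-suc a e)) (m+[n+o]∸n≡m+o (suc k) (suc a) e)) ⟩
    fibonomial s t (suc k ℕ.+ suc e) (suc k) * F (suc D) - F (suc a ℕ.+ (suc k ℕ.+ suc e)) * fibonomial s t (suc k ℕ.+ e) (suc k)
      ≈⟨ contiguity-core k a e ⟩
    F (suc a) * ((- t) ^ suc e * fibonomial s t (k ℕ.+ suc e) k)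
      ≡⟨ ≡.cong₂ (λ x y → F (suc a) * ((- t) ^ x * fibonomial s t y k)) (ℕₚ.m+n∸m≡n a (suc e)) (m+[n+o]∸n≡m+o k a (suc e)) ⟨
    F (suc a) * ((- t) ^ (D ∸ a) * fibonomial s t (k ℕ.+ D ∸ a) k) ∎
    where D = a ℕ.+ suc e

  fibonomial-contiguity : ∀ k a D → a ≤ k → Contiguity k a D
  fibonomial-contiguity k a D a≤k with ℕₚ.<-cmp D a
  ... | tri< D<a _ _ = begin
    fibonomial s t (suc k ℕ.+ D ∸ a) (suc k) * F (suc D) - F (suc k ℕ.+ suc D) * fibonomial s t (suc k ℕ.+ D ∸ suc a) (suc k)
      ≈⟨ +-cong (≈0⇒*≈0ˡ (fibonomial-> (m+n∸o<m D<a (ℕₚ.m≤n⇒m≤1+n a≤k))))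
                (-‿cong (≈0⇒*≈0ʳ (fibonomial-> (m+n∸o<m (ℕₚ.m<n⇒m<1+n D<a) (s≤s a≤k))))) ⟩
    0# - 0#
      ≈⟨ -‿inverseʳ 0# ⟩
    0#
      ≈⟨ ≈0⇒*≈0ʳ (≈0⇒*≈0ʳ (fibonomial-> (m+n∸o<m D<a a≤k))) ⟨
    F (suc a) * ((- t) ^ (D ∸ a) * fibonomial s t (k ℕ.+ D ∸ a) k) ∎
  ... | tri≈ _ ≡.refl _ = begin
    fibonomial s t (suc k ℕ.+ a ∸ a) (suc k) * F (suc a) - F (suc k ℕ.+ suc a) * fibonomial s t (suc k ℕ.+ a ∸ suc a) (suc k)
      ≈⟨ +-cong (*-congʳ (trans (fibonomial-cong (suc k) (ℕₚ.m+n∸n≡m (suc k) a)) (fibonomial-diagonal (suc k))))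
                (-‿cong (≈0⇒*≈0ʳ (fibonomial-> (m+n∸o<m (ℕₚ.n<1+n a) (s≤s a≤k))))) ⟩
    1# * F (suc a) - 0#
      ≈⟨ trans (+-cong (*-identityˡ _) -0#≈0#) (+-identityʳ _) ⟩
    F (suc a)
      ≈⟨ trans (*-congˡ (*-identityˡ 1#)) (*-identityʳ _) ⟨
    F (suc a) * (1# * 1#)
      ≈⟨ *-congˡ (*-cong (^-congʳ (- t) (ℕₚ.n∸n≡0 a))
                         (trans (fibonomial-cong k (ℕₚ.m+n∸n≡m k a)) (fibonomial-diagonal k))) ⟨
    F (suc a) * ((- t) ^ (a ∸ a) * fibonomial s t (k ℕ.+ a ∸ a) k) ∎
  ... | tri> _ _ a<D = ≡.subst (Contiguity k a) D′≡D (contiguity-gap k a (D ∸ suc a))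
    where
    D′≡D : a ℕ.+ suc (D ∸ suc a) ≡ D
    D′≡D = ≡.trans (ℕₚ.+-suc a _) (ℕₚ.m+[n∸m]≡n a<D)

  F!-∏ : ∀ m k → F! m * ∏ k (λ a → F (suc (m ℕ.+ a))) ≈ F! (m ℕ.+ k)
  F!-∏ m zero    = trans (*-identityʳ _) (reflexive (≡.cong F! (≡.sym (ℕₚ.+-identityʳ m))))
  F!-∏ m (suc k) = begin
    F! m * (F (suc (m ℕ.+ 0)) * ∏ k (λ a → F (suc (m ℕ.+ suc a))))
      ≈⟨ *-congˡ (*-cong (F-cong (≡.cong suc (ℕₚ.+-identityʳ m))) (∏-cong k λ a _ → F-cong (≡.cong suc (ℕₚ.+-suc m a)))) ⟩
    F! m * (F (suc m) * ∏ k (λ a → F (suc (suc m ℕ.+ a))))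
      ≈⟨ *-assoc _ _ _ ⟨
    F! (suc m) * ∏ k (λ a → F (suc (suc m ℕ.+ a)))
      ≈⟨ F!-∏ (suc m) k ⟩
    F! (suc m ℕ.+ k)
      ≡⟨ ≡.cong F! (ℕₚ.+-suc m k) ⟨
    F! (m ℕ.+ suc k)                                        ∎

  fibonomial⁻¹≈∏ : ∀ k e → fibonomial s t (k ℕ.+ e) e ⁻¹ ≈ ∏ k (F ∘ suc) * ∏ k (λ b → F (suc (e ℕ.+ b)) ⁻¹)
  fibonomial⁻¹≈∏ k e = sym (⁻¹-unique B≉0 (begin
    B * (∏ k (F ∘ suc) * Pinv)  ≈⟨ *-congˡ (*-congʳ (trans (sym (*-identityˡ _)) (F!-∏ 0 k))) ⟩
    B * (F! k * Pinv)           ≈⟨ *-assoc _ _ _ ⟨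
    B * F! k * Pinv             ≈⟨ *-congʳ B-F!k ⟩
    Pd * Pinv                   ≈⟨ *-comm _ _ ⟩
    Pinv * Pd                   ≈⟨ ∏-⁻¹ k (λ b → F (suc (e ℕ.+ b))) (λ b → F≉0 (e ℕ.+ b)) ⟩
    1#                          ∎))
    where
    B    = fibonomial s t (k ℕ.+ e) e
    Pd   = ∏ k (λ b → F (suc (e ℕ.+ b)))
    Pinv = ∏ k (λ b → F (suc (e ℕ.+ b)) ⁻¹)
    B-F! : B * F! e * F! k ≈ F! (k ℕ.+ e)
    B-F! = ≡.subst (λ i → B * F! e * F! i ≈ F! (k ℕ.+ e)) (ℕₚ.m+n∸n≡m k e) (fibonomial-F! (ℕₚ.m≤n+m e k))
    B≉0 : B ≉ 0#
    B≉0 B≈0 = F!≉0 (k ℕ.+ e) (trans (sym B-F!) (≈0⇒*≈0ˡ (≈0⇒*≈0ˡ B≈0)))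
    B-F!k : B * F! k ≈ Pd
    B-F!k = *-cancelʳ (F! e) (F!≉0 e) (begin
      B * F! k * F! e  ≈⟨ solve 3 (λ b x y → b :* x :* y := b :* y :* x) refl B (F! k) (F! e) ⟩
      B * F! e * F! k  ≈⟨ B-F! ⟩
      F! (k ℕ.+ e)     ≡⟨ ≡.cong F! (ℕₚ.+-comm k e) ⟩
      F! (e ℕ.+ k)     ≈⟨ F!-∏ e k ⟨
      F! e * Pd        ≈⟨ *-comm _ _ ⟩
      Pd * F! e        ∎)

module HoggattMatrix {c ℓ : Level} (K : Field c ℓ) (s t : Field.Carrier K)
  (F≉0 : ∀ m → ¬ (Field._≈_ K (FieldDefs.F K s t (suc m)) (Field.0# K))) (d : ℕ) where
  open Field K hiding (zero)
  open FieldDefs K using (_/_; fibonomial; hoggatt)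
  open IntegerCoefficientSolver commutativeRing
  open Determinant commutativeRing
  open FieldProperties K
  open Fibonomials K s t F≉0
  open import Algebra.Properties.Semiring.Exp semiring using (_^_; ^-congʳ; ^-homo-*)
  open import Relation.Binary.Reasoning.Setoid setoid

  -- M k is the matrix of the theorem for n = k + 1.
  M : ℕ → Matrix
  M k i j = fibonomial s t (k ℕ.+ d ℕ.+ j ∸ i) k

  κ : ℕ → ℕ → Carrier
  κ k zero    = 0#
  κ k (suc b) = - (F (k ℕ.+ suc (d ℕ.+ b)) / F (suc (d ℕ.+ b)))

  sweep-M-firstRow≈0 : ∀ k b → sweep (M k) (κ k) 0 (suc b) ≈ 0#
  sweep-M-firstRow≈0 k b = begin
    fibonomial s t (k ℕ.+ d ℕ.+ suc b) k + κ k (suc b) * fibonomial s t (k ℕ.+ d ℕ.+ b) k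
      ≈⟨ +-cong (fibonomial-cong k k+d+1+b≡k+1+D) (*-congˡ (fibonomial-cong k (ℕₚ.+-assoc k d b))) ⟩
    fibonomial s t (k ℕ.+ suc D) k + κ k (suc b) * fibonomial s t (k ℕ.+ D) k
      ≈⟨ x+-[y/z]*u≈[x*z-y*u]/z _ _ _ (F≉0 D) ⟩
    (fibonomial s t (k ℕ.+ suc D) k * F (suc D) - F (k ℕ.+ suc D) * fibonomial s t (k ℕ.+ D) k) / F (suc D)
      ≈⟨ *-congʳ (trans (+-congʳ (fibonomial-absorption-complement k D)) (-‿inverseʳ _)) ⟩
    0# / F (suc D) ≈⟨ zeroˡ _ ⟩
    0# ∎
    where
    D = d ℕ.+ b
    k+d+1+b≡k+1+D : k ℕ.+ d ℕ.+ suc b ≡ k ℕ.+ suc D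
    k+d+1+b≡k+1+D = ≡.trans (ℕₚ.+-assoc k d (suc b)) (≡.cong (k ℕ.+_) (ℕₚ.+-suc d b))

  sweep-M-lowerRows : ∀ k a b → a ≤ k →
    sweep (M (suc k)) (κ (suc k)) (suc a) (suc b) ≈ F (suc a) * ((- t) ^ (d ℕ.+ b ∸ a) * M k a b * F (suc (d ℕ.+ b)) ⁻¹)
  sweep-M-lowerRows k a b a≤k = begin
    fibonomial s t (suc k ℕ.+ d ℕ.+ suc b ∸ suc a) (suc k) + κ (suc k) (suc b) * fibonomial s t (suc k ℕ.+ d ℕ.+ b ∸ suc a) (suc k)
      ≈⟨ +-cong (fibonomial-cong (suc k) (≡.cong (_∸ a) k+d+1+b≡1+k+D))
                (*-congˡ (fibonomial-cong (suc k) (≡.cong (_∸ suc a) (ℕₚ.+-assoc (suc k) d b)))) ⟩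
    fibonomial s t (suc k ℕ.+ D ∸ a) (suc k) + κ (suc k) (suc b) * fibonomial s t (suc k ℕ.+ D ∸ suc a) (suc k)
      ≈⟨ x+-[y/z]*u≈[x*z-y*u]/z _ _ _ (F≉0 D) ⟩
    (fibonomial s t (suc k ℕ.+ D ∸ a) (suc k) * F (suc D) - F (suc k ℕ.+ suc D) * fibonomial s t (suc k ℕ.+ D ∸ suc a) (suc k)) / F (suc D)
      ≈⟨ *-congʳ (fibonomial-contiguity k a D a≤k) ⟩
    F (suc a) * ((- t) ^ (D ∸ a) * fibonomial s t (k ℕ.+ D ∸ a) k) * F (suc D) ⁻¹
      ≈⟨ trans (*-assoc _ _ _) (*-congˡ (*-congʳ (*-congˡ (fibonomial-cong k (≡.cong (_∸ a) (≡.sym (ℕₚ.+-assoc k d b))))))) ⟩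
    F (suc a) * ((- t) ^ (D ∸ a) * M k a b * F (suc D) ⁻¹) ∎
    where
    D = d ℕ.+ b
    k+d+1+b≡1+k+D : k ℕ.+ d ℕ.+ suc b ≡ suc k ℕ.+ D
    k+d+1+b≡1+k+D = ≡.trans (ℕₚ.+-assoc k d (suc b)) (≡.trans (≡.cong (k ℕ.+_) (ℕₚ.+-suc d b)) (ℕₚ.+-suc k D))

  M-staircase : ∀ n k → n ≤ suc k → Staircase n (λ i → i) (λ j → d ℕ.+ j) (M k)
  M-staircase n k n≤1+k i j i<n _ d+j<i = trans
    (fibonomial-cong k (≡.cong (_∸ i) (ℕₚ.+-assoc k d j)))
    (fibonomial-> (m+n∸o<m d+j<i (ℕₚ.≤-pred (ℕₚ.≤-trans i<n n≤1+k))))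

  det′-sweep-M-minor : ∀ n k → n ≤ k →
    det′ n (minor (sweep (M k) (κ k)) 0)
      ≈ ∏ n (F ∘ suc) * (∏ n (λ b → F (suc (d ℕ.+ b)) ⁻¹) * ((- t) ^ (n ℕ.* d) * det′ n (M (ℕ.pred k))))
  det′-sweep-M-minor zero    k       _      = sym (trans (*-identityˡ _) (trans (*-identityˡ _) (*-identityˡ _)))
  det′-sweep-M-minor (suc n) (suc k) n<1+k = begin
    det′ (suc n) (minor (sweep (M (suc k)) (κ (suc k))) 0)
      ≈⟨ det′-cong (suc n) (λ a b a<1+n _ → sweep-M-lowerRows k a b (ℕₚ.≤-pred (ℕₚ.≤-trans a<1+n n<1+k))) ⟩
    det′ (suc n) (λ a b → ρ a * (Z a b * γ b))
      ≈⟨ det′-scale-rows (suc n) ρ (λ a b → Z a b * γ b) ⟩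
    ∏ (suc n) ρ * det′ (suc n) (λ a b → Z a b * γ b)
      ≈⟨ *-congˡ (det′-scale-columns (suc n) γ Z) ⟩
    ∏ (suc n) ρ * (∏ (suc n) γ * det′ (suc n) Z)
      ≈⟨ *-congˡ (*-congˡ (det′-staircase-powers (suc n) (- t) (M-staircase (suc n) k n<1+k))) ⟩
    ∏ (suc n) ρ * (∏ (suc n) γ * ((- t) ^ (∑ℕ (suc n) (d ℕ.+_) ∸ ∑ℕ (suc n) (λ i → i)) * det′ (suc n) (M k)))
      ≡⟨ ≡.cong (λ e → ∏ (suc n) ρ * (∏ (suc n) γ * ((- t) ^ e * det′ (suc n) (M k)))) exponent ⟩
    ∏ (suc n) ρ * (∏ (suc n) γ * ((- t) ^ (suc n ℕ.* d) * det′ (suc n) (M k))) ∎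
    where
    ρ γ : ℕ → Carrier
    ρ a = F (suc a)
    γ b = F (suc (d ℕ.+ b)) ⁻¹
    Z : Matrix
    Z a b = (- t) ^ (d ℕ.+ b ∸ a) * M k a b
    exponent : ∑ℕ (suc n) (d ℕ.+_) ∸ ∑ℕ (suc n) (λ i → i) ≡ suc n ℕ.* d
    exponent = ≡.trans (≡.cong (_∸ ∑ℕ (suc n) (λ i → i)) (∑ℕ-shift (suc n) d (λ i → i)))
                       (ℕₚ.m+n∸n≡m (suc n ℕ.* d) (∑ℕ (suc n) (λ i → i)))

  det′-M-recurrence : ∀ k N → k ≤ N →
    det′ (suc k) (M N)
      ≈ fibonomial s t (N ℕ.+ d) d * (fibonomial s t (k ℕ.+ d) d ⁻¹ * ((- t) ^ (k ℕ.* d) * det′ k (M (ℕ.pred N))))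
  det′-M-recurrence k N k≤N = begin
    det′ (suc k) (M N)
      ≈⟨ det′-sweep (suc k) (M N) (κ N) ⟨
    det′ (suc k) (sweep (M N) (κ N))
      ≈⟨ det′-firstRow-pivot k (sweep (M N) (κ N)) (λ b _ → sweep-M-firstRow≈0 N b) ⟩
    M N 0 0 * det′ k (minor (sweep (M N) (κ N)) 0)
      ≈⟨ *-cong M₀₀ (det′-sweep-M-minor k N k≤N) ⟩
    fibonomial s t (N ℕ.+ d) d * (∏ k (F ∘ suc) * (∏ k (λ b → F (suc (d ℕ.+ b)) ⁻¹) * X))
      ≈⟨ *-congˡ (trans (sym (*-assoc _ _ _)) (*-congʳ (sym (fibonomial⁻¹≈∏ k d)))) ⟩
    fibonomial s t (N ℕ.+ d) d * (fibonomial s t (k ℕ.+ d) d ⁻¹ * X) ∎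
    where
    X = (- t) ^ (k ℕ.* d) * det′ k (M (ℕ.pred N))
    M₀₀ : M N 0 0 ≈ fibonomial s t (N ℕ.+ d) d
    M₀₀ = trans (fibonomial-cong N (ℕₚ.+-identityʳ (N ℕ.+ d))) (fibonomial-symmetric N d)

  hoggatt-suc : ∀ N k → hoggatt s t d (suc N) (suc k)
    ≈ fibonomial s t (N ℕ.+ d) d / fibonomial s t (k ℕ.+ d) d * hoggatt s t d N k
  hoggatt-suc N k = trans (prod≈∏ (suc k) _) (*-congˡ (sym (prod≈∏ k _)))

  hoggatt-pred : ∀ N k → k ≤ N → hoggatt s t d (suc (ℕ.pred N)) k ≈ hoggatt s t d N k
  hoggatt-pred zero    zero _ = refl
  hoggatt-pred (suc N) k    _ = refl

  det′-M≈hoggatt : ∀ k N → k ≤ suc N → det′ k (M N) ≈ (- t) ^ ((k C 2) ℕ.* d) * hoggatt s t d (suc N) k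
  det′-M≈hoggatt zero    N _       = sym (*-identityˡ 1#)
  det′-M≈hoggatt (suc k) N k<1+N = begin
    det′ (suc k) (M N)
      ≈⟨ det′-M-recurrence k N k≤N ⟩
    A * (B ⁻¹ * (W₁ * det′ k (M (ℕ.pred N))))
      ≈⟨ *-congˡ (*-congˡ (*-congˡ (trans (det′-M≈hoggatt k (ℕ.pred N) (ℕₚ.≤-trans k≤N (n≤1+pred[n] N)))
                                          (*-congˡ (hoggatt-pred N k k≤N))))) ⟩
    A * (B ⁻¹ * (W₁ * (W₂ * hoggatt s t d N k)))
      ≈⟨ solve 5 (λ a b w v h → a :* (b :* (w :* (v :* h))) := w :* v :* (a :* b :* h)) refl A (B ⁻¹) W₁ W₂ _ ⟩
    W₁ * W₂ * (A / B * hoggatt s t d N k)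
      ≈⟨ *-cong (trans (sym (^-homo-* (- t) (k ℕ.* d) ((k C 2) ℕ.* d))) (^-congʳ (- t) exponent))
                (sym (hoggatt-suc N k)) ⟩
    (- t) ^ ((suc k C 2) ℕ.* d) * hoggatt s t d (suc N) (suc k) ∎
    where
    k≤N = ℕₚ.≤-pred k<1+N
    A = fibonomial s t (N ℕ.+ d) d
    B = fibonomial s t (k ℕ.+ d) d
    W₁ = (- t) ^ (k ℕ.* d)
    W₂ = (- t) ^ ((k C 2) ℕ.* d)
    exponent : k ℕ.* d ℕ.+ (k C 2) ℕ.* d ≡ (suc k C 2) ℕ.* d
    exponent = ≡.trans (≡.sym (ℕₚ.*-distribʳ-+ d k (k C 2))) (≡.cong (ℕ._* d) (≡.sym ([1+k]C2≡k+kC2 k)))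

module FinIndexedDeterminant {c ℓ : Level} (K : Field c ℓ) where
  open Field K hiding (zero)
  open FieldDefs K using (det; sumFin; sign)
  open Determinant commutativeRing using (Matrix; ∑; sgn; minor; det′)

  toℕ-punchIn : ∀ {n} (l : Fin (suc n)) (b : Fin n) → toℕ (Fin.punchIn l b) ≡ punchIn (toℕ l) (toℕ b)
  toℕ-punchIn Fin.zero    b          = ≡.refl
  toℕ-punchIn (Fin.suc l) Fin.zero    = ≡.refl
  toℕ-punchIn (Fin.suc l) (Fin.suc b) = ≡.cong suc (toℕ-punchIn l b)

  sign≈sgn : ∀ {n} (j : Fin n) → sign j ≈ sgn (toℕ j)
  sign≈sgn Fin.zero    = refl
  sign≈sgn (Fin.suc j) = -‿cong (sign≈sgn j)

  sumFin≈∑ : ∀ n {f} g → (∀ j → f j ≈ g (toℕ j)) → sumFin n f ≈ ∑ n g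
  sumFin≈∑ zero    _ _   = refl
  sumFin≈∑ (suc n) g f≈g = +-cong (f≈g Fin.zero) (sumFin≈∑ n (λ j → g (suc j)) (λ j → f≈g (Fin.suc j)))

  det≈det′ : ∀ n {A} (B : Matrix) → (∀ i j → A i j ≈ B (toℕ i) (toℕ j)) → det n A ≈ det′ n B
  det≈det′ zero    B _   = refl
  det≈det′ (suc n) B A≈B = sumFin≈∑ (suc n) (λ l → sgn l * B 0 l * det′ n (minor B l)) λ l →
    *-cong (*-cong (sign≈sgn l) (A≈B Fin.zero l))
           (det≈det′ n (minor B (toℕ l)) λ i j →
              trans (A≈B (Fin.suc i) (Fin.punchIn l j)) (reflexive (≡.cong (B (suc (toℕ i))) (toℕ-punchIn l j))))

theorem16 : ∀ {c ℓ : Level} (K : Field c ℓ) →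
    let open Field K
        open FieldDefs K
    in
    (s t : Carrier) → (∀ m → ¬ (F s t (suc m) ≈ 0#)) →
    (d n k : ℕ) → 1 ≤ d → 1 ≤ n → k ≤ n →
    det k (λ i j → fibonomial s t ((n ℕ.+ d ℕ.+ toℕ j ∸ 1) ∸ toℕ i) (n ∸ 1))
      ≈ pow (- t) ((k C 2) ℕ.* d) * hoggatt s t d n k
theorem16 K s t F≉0 d zero    k _ () _
theorem16 K s t F≉0 d (suc N) k _ _  k≤1+N = begin
  det k _                                              ≈⟨ det≈det′ k (M N) (λ _ _ → refl) ⟩
  det′ k (M N)                                         ≈⟨ det′-M≈hoggatt k N k≤1+N ⟩
  (- t) ^ ((k C 2) ℕ.* d) * hoggatt s t d (suc N) k    ≈⟨ *-congʳ (pow≈^ (- t) ((k C 2) ℕ.* d)) ⟨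
  pow (- t) ((k C 2) ℕ.* d) * hoggatt s t d (suc N) k  ∎
  where
  open Field K
  open FieldDefs K using (det; pow; hoggatt)
  open Determinant commutativeRing using (det′)
  open FieldProperties K using (pow≈^)
  open FinIndexedDeterminant K using (det≈det′)
  open HoggattMatrix K s t F≉0 d using (M; det′-M≈hoggatt)
  open import Algebra.Properties.Semiring.Exp semiring using (_^_)
  open import Relation.Binary.Reasoning.Setoid setoid
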